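{- Let $n\ge2$ and $f\in\mathfrak{T}(2,n,*)$ with $P(f)$ of positive area. Then $D(f)=\Delta P(f)\cap M_0(f)$.
   Context: $E_n^2=\{0,\dots,n-1\}^2$, $M_\nu(f)=\{x\in E_n^2: f(x)=\nu\}$. $\mathfrak{T}(2,n,*)$ is the class of functions $f:E_n^2\to\{0,1\}$ for which, for some $k$, there are reals $a_{ij}$ with $M_1(f)=\{x\in E_n^2: a_{i1}x_1+a_{i2}x_2\le a_{i0},\ i=1,\dots,k\}$. $P(f)=\textup{Conv}(M_1(f))$. $D(f)=\{x\in M_0(f):\textup{Conv}(P(f)\cup\{x\})\cap M_0(f)=\{x\}\}$. When $P(f)$ is a polygon of positive area, each edge $e$ lies on a line $a_1x_1+a_2x_2=a_0$ with $a_1,a_2$ coprime integers (so $a_0$ is an integer), oriented so that $a_1x_1+a_2x_2\le a_0$ holds on $P(f)$ (the edge inequality); the extended edge inequality is $a_1x_1+a_2x_2\le a_0+1$. $P'(f)\subseteq\mathbb{R}^2$ is the set of points satisfying the extended edge inequalities of all edges of $P(f)$, and $\Delta P(f)=P'(f)\setminus P(f)$.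
   Formalization: The coefficients $a_{ij}$ defining $\mathfrak{T}(2,n,*)$ are rational rather than real, and convex hulls, hence $P(f)$, $\Delta P(f)$ and $D(f)$, are formed with rational convex weights. -}

module Defs where

open import Data.Bool using (Bool; true; false)
open import Data.Nat as ℕ using (ℕ)
open import Data.Nat.Coprimality using (Coprime)
open import Data.Fin using (Fin; toℕ) renaming (zero to fzero; suc to fsuc)
open import Data.Integer as ℤ using (ℤ; +_; ∣_∣)
open import Data.Rational as ℚ using (ℚ; 0ℚ; 1ℚ)
open import Data.Product using (Σ; ∃; _×_; _,_)
open import Data.Sum using (_⊎_)
open import Relation.Nullary using (¬_)
open import Relation.Binary.PropositionalEquality using (_≡_; _≢_)

E : ℕ → Set
E n = Fin n × Fin n

BFun : ℕ → Set
BFun n = E n → Bool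

M : ∀ {n} → BFun n → Bool → E n → Set
M f ν x = f x ≡ ν

x₁ℤ x₂ℤ : ∀ {n} → E n → ℤ
x₁ℤ (i , j) = + toℕ i
x₂ℤ (i , j) = + toℕ j

x₁ℚ x₂ℚ : ∀ {n} → E n → ℚ
x₁ℚ p = x₁ℤ p ℚ./ 1
x₂ℚ p = x₂ℤ p ℚ./ 1

Σℚ : (k : ℕ) → (Fin k → ℚ) → ℚ
Σℚ ℕ.zero    g = 0ℚ
Σℚ (ℕ.suc k) g = g fzero ℚ.+ Σℚ k (λ i → g (fsuc i))

-- The class 𝔗(2,n,*): M₁(f) is cut out of E_n^2 by finitely many
-- linear inequalities a_{i1} x₁ + a_{i2} x₂ ≤ a_{i0} (rational coefficients).
Ineq : Set
Ineq = ℚ × ℚ × ℚ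

satisfies : ∀ {n} → Ineq → E n → Set
satisfies (a₁ , a₂ , a₀) x = (a₁ ℚ.* x₁ℚ x ℚ.+ a₂ ℚ.* x₂ℚ x) ℚ.≤ a₀

InT2 : (n : ℕ) → BFun n → Set
InT2 n f = Σ ℕ λ k → Σ (Fin k → Ineq) λ a →
  ∀ x → (f x ≡ true → ∀ i → satisfies (a i) x)
      × ((∀ i → satisfies (a i) x) → f x ≡ true)

InConv : ∀ {n} → (E n → Set) → E n → Set
InConv {n} S y = Σ ℕ λ k → Σ (Fin k → ℚ) λ w → Σ (Fin k → E n) λ q →
    (∀ i → 0ℚ ℚ.≤ w i)
  × (∀ i → S (q i))
  × (Σℚ k w ≡ 1ℚ)
  × (Σℚ k (λ i → w i ℚ.* x₁ℚ (q i)) ≡ x₁ℚ y)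
  × (Σℚ k (λ i → w i ℚ.* x₂ℚ (q i)) ≡ x₂ℚ y)

-- P(f) = Conv(M₁(f)); membership of grid points
InP : ∀ {n} → BFun n → E n → Set
InP f = InConv (M f true)

-- P(f) has positive area: M₁(f) contains three non-collinear points
PositiveArea : ∀ {n} → BFun n → Set
PositiveArea {n} f = Σ (E n) λ u → Σ (E n) λ v → Σ (E n) λ w →
  M f true u × M f true v × M f true w ×
  (((x₁ℤ v ℤ.- x₁ℤ u) ℤ.* (x₂ℤ w ℤ.- x₂ℤ u))
     ≢ ((x₂ℤ v ℤ.- x₂ℤ u) ℤ.* (x₁ℤ w ℤ.- x₁ℤ u)))

-- D(f) = {x ∈ M₀(f) : Conv(P(f) ∪ {x}) ∩ M₀(f) = {x}}
-- (Conv(P(f) ∪ {x}) = Conv(M₁(f) ∪ {x}))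
InD : ∀ {n} → BFun n → E n → Set
InD f x = M f false x ×
  (∀ y → M f false y → InConv (λ q → M f true q ⊎ q ≡ x) y → y ≡ x)

lin : ∀ {n} → ℤ → ℤ → E n → ℤ
lin a₁ a₂ x = a₁ ℤ.* x₁ℤ x ℤ.+ a₂ ℤ.* x₂ℤ x

-- a₁x₁ + a₂x₂ ≤ a₀ is the edge inequality of an edge of P(f):
-- a₁, a₂ coprime integers, valid on P(f), and the line a₁x₁+a₂x₂ = a₀
-- contains two distinct points of M₁(f) (hence an edge, as P(f) is a polygon).
EdgeIneq : ∀ {n} → BFun n → ℤ → ℤ → ℤ → Set
EdgeIneq {n} f a₁ a₂ a₀ =
    Coprime ∣ a₁ ∣ ∣ a₂ ∣
  × (∀ x → M f true x → lin a₁ a₂ x ℤ.≤ a₀)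
  × Σ (E n) λ u → Σ (E n) λ v → u ≢ v × M f true u × M f true v
      × lin a₁ a₂ u ≡ a₀ × lin a₁ a₂ v ≡ a₀

-- grid points of P'(f): satisfy every extended edge inequality
InP' : ∀ {n} → BFun n → E n → Set
InP' f x = ∀ a₁ a₂ a₀ → EdgeIneq f a₁ a₂ a₀ → lin a₁ a₂ x ℤ.≤ a₀ ℤ.+ ℤ.1ℤ

InΔP : ∀ {n} → BFun n → E n → Set
InΔP f x = InP' f x × ¬ InP f x

-- ΔP ∩ M₀ ⊆ D.  A point y ∈ M₀(f) violates one of the inequalities defining f. Take u ∈ M₁(f)
-- maximising that functional and turn a line about u until it meets a second point r of M₁(f)
-- while keeping M₁(f) on one side; positive area guarantees that such an r exists. The result is
-- an edge a·z ≤ a₀ of P(f) with a·y > a₀. If x satisfies every extended edge inequality and y is a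
-- convex combination of M₁(f) ∪ {x}, then every point of M₁(f) has a·z < a₀ + 1 ≤ a·y while
-- a·x ≤ a₀ + 1, so all the weight lies on x and y = x.
--
-- D ⊆ ΔP ∩ M₀.  A point of D is not in P(f), because M₁(f) is cut out by linear inequalities and
-- so contains every grid point of P(f). Suppose x ∈ D but a·x ≥ a₀ + 2 for some edge through
-- u, v ∈ M₁(f). As a is primitive, a·e = 1 for some lattice vector e (Bézout), and the lattice
-- points on the line a·z = a₀ + 1 are the points u + e + t·perp a. Division with remainder picks
-- t such that this point lies in the triangle u v x, which gives a point of M₀(f) other than x
-- in Conv(M₁(f) ∪ {x}).

module Submission where

open import Defs
open import Data.Bool using (true; false)
import Data.Bool as Bool
import Data.Bool.Properties as BoolP
open import Data.Empty using (⊥; ⊥-elim)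
open import Data.Fin using (Fin; toℕ; fromℕ<) renaming (zero to fzero; suc to fsuc)
import Data.Fin.Properties as FinP
open import Data.Integer as ℤ using (ℤ; +_; -[1+_]; ∣_∣; 0ℤ; 1ℤ; _◃_)
open import Data.Integer.DivMod using (_%ℕ_; _/ℕ_; n%ℕd<d; a≡a%ℕn+[a/ℕn]*n)
import Data.Integer.Properties as ℤP
import Data.Integer.Solver as ℤSolver
open import Data.List using (List; []; _∷_; filter; cartesianProduct; allFin)
import Data.List.Extrema
open import Data.List.Membership.Propositional using (_∈_)
open import Data.List.Membership.Propositional.Properties
  using (∈-filter⁺; ∈-filter⁻; ∈-cartesianProduct⁺; ∈-allFin)
open import Data.List.Relation.Unary.All as All using (All)
open import Data.List.Relation.Unary.Any using (here; there)
open import Data.Nat as ℕ using (ℕ; zero; suc; _≤_; z≤n; s≤s)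
open import Data.Nat.Coprimality as Coprimality using (Coprime; coprime-/gcd)
open import Data.Nat.DivMod using (m/n*n≡m)
open import Data.Nat.Divisibility using () renaming (_∣_ to _∣ℕ_)
open import Data.Nat.GCD using (gcd; gcd[m,n]∣m; gcd[m,n]∣n; gcd[m,n]≡0⇒m≡0; gcd[m,n]≡0⇒n≡0; module Bézout)
import Data.Nat.Properties as ℕP
open import Data.Product using (Σ; _×_; _,_; proj₁; proj₂)
import Data.Product
open import Data.Rational as ℚ using (ℚ; 0ℚ; 1ℚ; mkℚ)
import Data.Rational.Properties as ℚP
import Data.Rational.Solver as ℚSolver
import Data.Sign as Sign
import Data.Sign.Properties as SignP
open import Data.Sum using (_⊎_; inj₁; inj₂)
import Data.Sum
open import Function using (_∘_)
open import Relation.Binary.Bundles using (DecTotalOrder)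
open import Relation.Binary.Definitions using (Tri; tri<; tri≈; tri>)
open import Relation.Binary.PropositionalEquality
open import Relation.Nullary using (¬_; yes; no; Dec)
open import Relation.Nullary.Decidable using (decidable-stable)
open import Relation.Unary using (Decidable)

module ℚExtrema = Data.List.Extrema (DecTotalOrder.totalOrder ℚP.≤-decTotalOrder)

-- x₁ℚ p is fromℤ (x₁ℤ p) by definition.
fromℤ : ℤ → ℚ
fromℤ z = z ℚ./ 1

private
  fromℤ≡mkℚ : ∀ z → fromℤ z ≡ mkℚ z 0 (Coprimality.sym (Coprimality.1-coprimeTo ∣ z ∣))
  fromℤ≡mkℚ (+ n)    = ℚP.normalize-coprime (Coprimality.sym (Coprimality.1-coprimeTo n))
  fromℤ≡mkℚ -[1+ n ] = cong ℚ.-_ (ℚP.normalize-coprime (Coprimality.sym (Coprimality.1-coprimeTo (suc n))))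

fromℤ-+ : ∀ a b → fromℤ (a ℤ.+ b) ≡ fromℤ a ℚ.+ fromℤ b
fromℤ-+ a b rewrite fromℤ≡mkℚ a | fromℤ≡mkℚ b =
  cong (ℚ._/ 1) (cong₂ ℤ._+_ (sym (ℤP.*-identityʳ a)) (sym (ℤP.*-identityʳ b)))

fromℤ-* : ∀ a b → fromℤ (a ℤ.* b) ≡ fromℤ a ℚ.* fromℤ b
fromℤ-* a b rewrite fromℤ≡mkℚ a | fromℤ≡mkℚ b = refl

fromℤ-neg : ∀ a → fromℤ (ℤ.- a) ≡ ℚ.- fromℤ a
fromℤ-neg a rewrite fromℤ≡mkℚ a | fromℤ≡mkℚ (ℤ.- a) = neg-mkℚ a
  where
  neg-mkℚ : ∀ a .{c : Coprime ∣ ℤ.- a ∣ 1} .{c′ : Coprime ∣ a ∣ 1} → mkℚ (ℤ.- a) 0 c ≡ ℚ.- mkℚ a 0 c′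
  neg-mkℚ (+ zero)  = refl
  neg-mkℚ (+ suc n) = refl
  neg-mkℚ -[1+ n ]  = refl

fromℤ-- : ∀ a b → fromℤ (a ℤ.- b) ≡ fromℤ a ℚ.- fromℤ b
fromℤ-- a b = trans (fromℤ-+ a (ℤ.- b)) (cong (fromℤ a ℚ.+_) (fromℤ-neg b))

fromℤ-mono-≤ : ∀ {a b} → a ℤ.≤ b → fromℤ a ℚ.≤ fromℤ b
fromℤ-mono-≤ {a} {b} a≤b rewrite fromℤ≡mkℚ a | fromℤ≡mkℚ b =
  ℚ.*≤* (subst₂ ℤ._≤_ (sym (ℤP.*-identityʳ a)) (sym (ℤP.*-identityʳ b)) a≤b)

fromℤ-cancel-≤ : ∀ {a b} → fromℤ a ℚ.≤ fromℤ b → a ℤ.≤ b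
fromℤ-cancel-≤ {a} {b} p rewrite fromℤ≡mkℚ a | fromℤ≡mkℚ b with p
... | ℚ.*≤* q = subst₂ ℤ._≤_ (ℤP.*-identityʳ a) (ℤP.*-identityʳ b) q

fromℤ-mono-< : ∀ {a b} → a ℤ.< b → fromℤ a ℚ.< fromℤ b
fromℤ-mono-< {a} {b} a<b rewrite fromℤ≡mkℚ a | fromℤ≡mkℚ b =
  ℚ.*<* (subst₂ ℤ._<_ (sym (ℤP.*-identityʳ a)) (sym (ℤP.*-identityʳ b)) a<b)

fromℤ-injective : ∀ {a b} → fromℤ a ≡ fromℤ b → a ≡ b
fromℤ-injective p = ℤP.≤-antisym (fromℤ-cancel-≤ (ℚP.≤-reflexive p)) (fromℤ-cancel-≤ (ℚP.≤-reflexive (sym p)))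

fromℤ-sum : ∀ a b c → fromℤ (a ℤ.+ b ℤ.+ c) ≡ fromℤ a ℚ.+ fromℤ b ℚ.+ fromℤ c
fromℤ-sum a b c = trans (fromℤ-+ (a ℤ.+ b) c) (cong (ℚ._+ fromℤ c) (fromℤ-+ a b))

fromℤ-combination : ∀ a b c p q r → fromℤ (a ℤ.* p ℤ.+ b ℤ.* q ℤ.+ c ℤ.* r)
  ≡ fromℤ a ℚ.* fromℤ p ℚ.+ fromℤ b ℚ.* fromℤ q ℚ.+ fromℤ c ℚ.* fromℤ r
fromℤ-combination a b c p q r = trans (fromℤ-+ (a ℤ.* p ℤ.+ b ℤ.* q) (c ℤ.* r))
  (cong₂ ℚ._+_ (trans (fromℤ-+ (a ℤ.* p) (b ℤ.* q)) (cong₂ ℚ._+_ (fromℤ-* a p) (fromℤ-* b q))) (fromℤ-* c r))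

p≤q⇒0≤q-p : ∀ {p q} → p ℚ.≤ q → 0ℚ ℚ.≤ q ℚ.- p
p≤q⇒0≤q-p {p} p≤q = ℚP.≤-trans (ℚP.≤-reflexive (sym (ℚP.+-inverseʳ p))) (ℚP.+-monoˡ-≤ (ℚ.- p) p≤q)

p<q⇒0<q-p : ∀ {p q} → p ℚ.< q → 0ℚ ℚ.< q ℚ.- p
p<q⇒0<q-p {p} p<q = ℚP.≤-<-trans (ℚP.≤-reflexive (sym (ℚP.+-inverseʳ p))) (ℚP.+-monoˡ-< (ℚ.- p) p<q)

p≤q⇒p-q≤0 : ∀ {p q} → p ℚ.≤ q → p ℚ.- q ℚ.≤ 0ℚ
p≤q⇒p-q≤0 {q = q} p≤q = ℚP.≤-trans (ℚP.+-monoˡ-≤ (ℚ.- q) p≤q) (ℚP.≤-reflexive (ℚP.+-inverseʳ q))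

ℚ-*-nonNeg : ∀ {p q} → 0ℚ ℚ.≤ p → 0ℚ ℚ.≤ q → 0ℚ ℚ.≤ p ℚ.* q
ℚ-*-nonNeg {p} {q} p≥0 q≥0 =
  ℚP.nonNegative⁻¹ _ {{ℚP.nonNeg*nonNeg⇒nonNeg p {{ℚ.nonNegative p≥0}} q {{ℚ.nonNegative q≥0}}}}

ℚ-nonNeg-factor : ∀ {x y p q} → x ℚ.* y ≡ p ℚ.+ q → 0ℚ ℚ.< y → 0ℚ ℚ.≤ p → 0ℚ ℚ.≤ q → 0ℚ ℚ.≤ x
ℚ-nonNeg-factor {x} {y} xy≡p+q y>0 p≥0 q≥0 = ℚP.*-cancelʳ-≤-pos y {{ℚ.positive y>0}}
  (subst (ℚ._≤ x ℚ.* y) (sym (ℚP.*-zeroˡ y)) (subst (0ℚ ℚ.≤_) (sym xy≡p+q) (ℚP.+-mono-≤ p≥0 q≥0)))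

ℤ-*-nonNeg : ∀ {i j} → 0ℤ ℤ.≤ i → 0ℤ ℤ.≤ j → 0ℤ ℤ.≤ i ℤ.* j
ℤ-*-nonNeg {i} {j} i≥0 j≥0 =
  subst (ℤ._≤ i ℤ.* j) (ℤP.*-zeroʳ i) (ℤP.*-monoˡ-≤-nonNeg i {{ℤ.nonNegative i≥0}} j≥0)

ℤ-nonNeg-factor : ∀ {x y p q} → x ℤ.* y ≡ p ℤ.+ q → 0ℤ ℤ.< y → 0ℤ ℤ.≤ p → 0ℤ ℤ.≤ q → 0ℤ ℤ.≤ x
ℤ-nonNeg-factor {x} {y} xy≡p+q y>0 p≥0 q≥0 = ℤP.*-cancelʳ-≤-pos 0ℤ x y {{ℤ.positive y>0}}
  (subst (ℤ._≤ x ℤ.* y) (sym (ℤP.*-zeroˡ y)) (subst (0ℤ ℤ.≤_) (sym xy≡p+q) (ℤP.+-mono-≤ p≥0 q≥0)))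

i<i+1 : ∀ i → i ℤ.< i ℤ.+ 1ℤ
i<i+1 i = subst (i ℤ.<_) (ℤP.+-comm 1ℤ i) (ℤP.suc[i]≤j⇒i<j ℤP.≤-refl)

i<j⇒i+1≤j : ∀ {i j} → i ℤ.< j → i ℤ.+ 1ℤ ℤ.≤ j
i<j⇒i+1≤j {i} i<j = subst (ℤ._≤ _) (ℤP.+-comm 1ℤ i) (ℤP.i<j⇒suc[i]≤j i<j)

i-j<0⇒i<j : ∀ {i j} → i ℤ.- j ℤ.< 0ℤ → i ℤ.< j
i-j<0⇒i<j {i} {j} i-j<0 = subst₂ ℤ._<_ [i-j]+j≡i (ℤP.+-identityˡ j) (ℤP.+-monoˡ-< j i-j<0)
  where
  [i-j]+j≡i : i ℤ.- j ℤ.+ j ≡ i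
  [i-j]+j≡i = trans (ℤP.+-assoc i (ℤ.- j) j) (trans (cong (λ t → i ℤ.+ t) (ℤP.+-inverseˡ j)) (ℤP.+-identityʳ i))

i<j⇒0<j-i : ∀ {i j} → i ℤ.< j → 0ℤ ℤ.< j ℤ.- i
i<j⇒0<j-i {i} {j} i<j = subst (ℤ._< j ℤ.- i) (ℤP.+-inverseʳ i) (ℤP.+-monoˡ-< (ℤ.- i) i<j)

positive⇒+[1+] : ∀ {d} → 0ℤ ℤ.< d → Σ ℕ λ h → d ≡ + suc h
positive⇒+[1+] {+ suc h}   _ = h , refl
positive⇒+[1+] {+ zero}    (ℤ.+<+ ())
positive⇒+[1+] { -[1+ _ ]} ()

Σℚ-cong : ∀ k {g h : Fin k → ℚ} → (∀ i → g i ≡ h i) → Σℚ k g ≡ Σℚ k h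
Σℚ-cong zero    g≡h = refl
Σℚ-cong (suc k) g≡h = cong₂ ℚ._+_ (g≡h fzero) (Σℚ-cong k (λ i → g≡h (fsuc i)))

Σℚ-+ : ∀ k (g h : Fin k → ℚ) → Σℚ k (λ i → g i ℚ.+ h i) ≡ Σℚ k g ℚ.+ Σℚ k h
Σℚ-+ zero    g h = refl
Σℚ-+ (suc k) g h rewrite Σℚ-+ k (λ i → g (fsuc i)) (λ i → h (fsuc i)) =
  interchange (g fzero) (h fzero) (Σℚ k (λ i → g (fsuc i))) (Σℚ k (λ i → h (fsuc i)))
  where
  open ℚSolver.+-*-Solver
  interchange : ∀ a b c d → (a ℚ.+ b) ℚ.+ (c ℚ.+ d) ≡ (a ℚ.+ c) ℚ.+ (b ℚ.+ d)
  interchange = solve 4 (λ a b c d → (a :+ b) :+ (c :+ d) := (a :+ c) :+ (b :+ d)) refl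

Σℚ-*ˡ : ∀ k c (g : Fin k → ℚ) → Σℚ k (λ i → c ℚ.* g i) ≡ c ℚ.* Σℚ k g
Σℚ-*ˡ zero    c g = sym (ℚP.*-zeroʳ c)
Σℚ-*ˡ (suc k) c g rewrite Σℚ-*ˡ k c (λ i → g (fsuc i)) = sym (ℚP.*-distribˡ-+ c (g fzero) _)

Σℚ-mono-≤ : ∀ k {g h : Fin k → ℚ} → (∀ i → g i ℚ.≤ h i) → Σℚ k g ℚ.≤ Σℚ k h
Σℚ-mono-≤ zero    g≤h = ℚP.≤-refl
Σℚ-mono-≤ (suc k) g≤h = ℚP.+-mono-≤ (g≤h fzero) (Σℚ-mono-≤ k (λ i → g≤h (fsuc i)))

Σℚ-nonNeg : ∀ k {g : Fin k → ℚ} → (∀ i → 0ℚ ℚ.≤ g i) → 0ℚ ℚ.≤ Σℚ k g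
Σℚ-nonNeg zero    g≥0 = ℚP.≤-refl
Σℚ-nonNeg (suc k) g≥0 = ℚP.+-mono-≤ (g≥0 fzero) (Σℚ-nonNeg k (λ i → g≥0 (fsuc i)))

Σℚ-nonNeg-≤0⇒≡0 : ∀ k {g : Fin k → ℚ} → (∀ i → 0ℚ ℚ.≤ g i) → Σℚ k g ℚ.≤ 0ℚ → ∀ i → g i ≡ 0ℚ
Σℚ-nonNeg-≤0⇒≡0 (suc k) {g} g≥0 Σg≤0 fzero = ℚP.≤-antisym
  (ℚP.≤-trans (ℚP.≤-trans (ℚP.≤-reflexive (sym (ℚP.+-identityʳ (g fzero))))
    (ℚP.+-monoʳ-≤ (g fzero) (Σℚ-nonNeg k (λ i → g≥0 (fsuc i))))) Σg≤0)
  (g≥0 fzero)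
Σℚ-nonNeg-≤0⇒≡0 (suc k) {g} g≥0 Σg≤0 (fsuc i) = Σℚ-nonNeg-≤0⇒≡0 k (λ i → g≥0 (fsuc i))
  (ℚP.≤-trans (ℚP.≤-trans (ℚP.≤-reflexive (sym (ℚP.+-identityˡ _)))
    (ℚP.+-monoˡ-≤ (Σℚ k (λ i → g (fsuc i))) (g≥0 fzero))) Σg≤0) i

Σℚ-linear : ∀ k (w X Y : Fin k → ℚ) α β →
  Σℚ k (λ i → w i ℚ.* (α ℚ.* X i ℚ.+ β ℚ.* Y i))
    ≡ α ℚ.* Σℚ k (λ i → w i ℚ.* X i) ℚ.+ β ℚ.* Σℚ k (λ i → w i ℚ.* Y i)
Σℚ-linear k w X Y α β = trans (Σℚ-cong k (λ i → distribute (w i) (X i) (Y i)))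
  (trans (Σℚ-+ k _ _) (cong₂ ℚ._+_ (Σℚ-*ˡ k α _) (Σℚ-*ˡ k β _)))
  where
  open ℚSolver.+-*-Solver
  distribute : ∀ w x y → w ℚ.* (α ℚ.* x ℚ.+ β ℚ.* y) ≡ α ℚ.* (w ℚ.* x) ℚ.+ β ℚ.* (w ℚ.* y)
  distribute = solve 5 (λ a b w x y → w :* (a :* x :+ b :* y) := a :* (w :* x) :+ b :* (w :* y)) refl α β

module Average {k : ℕ} {w : Fin k → ℚ} (w≥0 : ∀ i → 0ℚ ℚ.≤ w i) (Σw≡1 : Σℚ k w ≡ 1ℚ) where

  const : ∀ c → Σℚ k (λ i → w i ℚ.* c) ≡ c
  const c = trans (Σℚ-cong k (λ i → ℚP.*-comm (w i) c))
    (trans (Σℚ-*ˡ k c w) (trans (cong (c ℚ.*_) Σw≡1) (ℚP.*-identityʳ c)))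

  mono-≤ : ∀ {F G : Fin k → ℚ} → (∀ i → F i ℚ.≤ G i) →
    Σℚ k (λ i → w i ℚ.* F i) ℚ.≤ Σℚ k (λ i → w i ℚ.* G i)
  mono-≤ F≤G = Σℚ-mono-≤ k (λ i → ℚP.*-monoˡ-≤-nonNeg (w i) {{ℚ.nonNegative (w≥0 i)}} (F≤G i))

  ≤-bound : ∀ {F : Fin k → ℚ} {b} → (∀ i → F i ℚ.≤ b) → Σℚ k (λ i → w i ℚ.* F i) ℚ.≤ b
  ≤-bound F≤b = ℚP.≤-trans (mono-≤ F≤b) (ℚP.≤-reflexive (const _))

  ≥-bound : ∀ {F : Fin k → ℚ} {b} → (∀ i → b ℚ.≤ F i) → b ℚ.≤ Σℚ k (λ i → w i ℚ.* F i)
  ≥-bound b≤F = ℚP.≤-trans (ℚP.≤-reflexive (sym (const _))) (mono-≤ b≤F)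

  concentrated : ∀ {X : Fin k → ℚ} {c} → (∀ i → w i ≡ 0ℚ ⊎ X i ≡ c) → Σℚ k (λ i → w i ℚ.* X i) ≡ c
  concentrated {X} {c} h = trans (Σℚ-cong k term) (const c)
    where
    term : ∀ i → w i ℚ.* X i ≡ w i ℚ.* c
    term i with h i
    ... | inj₂ Xi≡c = cong (w i ℚ.*_) Xi≡c
    ... | inj₁ wi≡0 rewrite wi≡0 = trans (ℚP.*-zeroˡ (X i)) (sym (ℚP.*-zeroˡ c))

  in-Fin : ∀ {N} (c : Fin k → Fin (suc N)) {Y} →
    Σℚ k (λ i → w i ℚ.* fromℤ (+ toℕ (c i))) ≡ fromℤ Y → Σ (Fin (suc N)) λ j → + toℕ j ≡ Y
  in-Fin {N} c ΣwC≡Y = in-range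
    (fromℤ-cancel-≤ (subst (0ℚ ℚ.≤_) ΣwC≡Y (≥-bound (λ i → fromℤ-mono-≤ {0ℤ} {+ toℕ (c i)} (ℤ.+≤+ z≤n)))))
    (fromℤ-cancel-≤ (subst (ℚ._≤ fromℤ (+ N)) ΣwC≡Y
      (≤-bound (λ i → fromℤ-mono-≤ {+ toℕ (c i)} {+ N} (ℤ.+≤+ (FinP.toℕ≤pred[n] (c i)))))))
    where
    in-range : ∀ {Y} → 0ℤ ℤ.≤ Y → Y ℤ.≤ + N → Σ (Fin (suc N)) λ j → + toℕ j ≡ Y
    in-range {+ _} _ (ℤ.+≤+ c≤N) = fromℕ< (s≤s c≤N) , cong +_ (FinP.toℕ-fromℕ< (s≤s c≤N))

  no-weight-below-max : ∀ {F : Fin k → ℚ} {b} → (∀ i → F i ℚ.≤ b) → b ℚ.≤ Σℚ k (λ i → w i ℚ.* F i) →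
    ∀ i → F i ℚ.< b → w i ≡ 0ℚ
  no-weight-below-max {F} {b} F≤b b≤ΣwF i Fi<b = ℚP.≤-antisym
    (ℚP.*-cancelʳ-≤-pos (b ℚ.- F i) {{ℚ.positive (p<q⇒0<q-p Fi<b)}}
      (ℚP.≤-reflexive (trans (slack≡0 i) (sym (ℚP.*-zeroˡ (b ℚ.- F i))))))
    (w≥0 i)
    where
    open ℚSolver.+-*-Solver
    Σslack : Σℚ k (λ i → w i ℚ.* (b ℚ.- F i)) ≡ b ℚ.- Σℚ k (λ i → w i ℚ.* F i)
    Σslack = begin
      Σℚ k (λ i → w i ℚ.* (b ℚ.- F i))
        ≡⟨ Σℚ-cong k (λ i → cong (w i ℚ.*_) (as-combination b (F i))) ⟩
      Σℚ k (λ i → w i ℚ.* (1ℚ ℚ.* b ℚ.+ (ℚ.- 1ℚ) ℚ.* F i))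
        ≡⟨ Σℚ-linear k w (λ _ → b) F 1ℚ (ℚ.- 1ℚ) ⟩
      1ℚ ℚ.* Σℚ k (λ i → w i ℚ.* b) ℚ.+ (ℚ.- 1ℚ) ℚ.* Σℚ k (λ i → w i ℚ.* F i)
        ≡⟨ cong (λ t → 1ℚ ℚ.* t ℚ.+ (ℚ.- 1ℚ) ℚ.* Σℚ k (λ i → w i ℚ.* F i)) (const b) ⟩
      1ℚ ℚ.* b ℚ.+ (ℚ.- 1ℚ) ℚ.* Σℚ k (λ i → w i ℚ.* F i)
        ≡⟨ sym (as-combination b _) ⟩
      b ℚ.- Σℚ k (λ i → w i ℚ.* F i) ∎
      where
      open ≡-Reasoning
      as-combination : ∀ b x → b ℚ.- x ≡ 1ℚ ℚ.* b ℚ.+ (ℚ.- 1ℚ) ℚ.* x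
      as-combination = solve 2 (λ b x → b :- x := con 1ℚ :* b :+ (:- con 1ℚ) :* x) refl
    slack≡0 : ∀ i → w i ℚ.* (b ℚ.- F i) ≡ 0ℚ
    slack≡0 = Σℚ-nonNeg-≤0⇒≡0 k (λ i → ℚ-*-nonNeg (w≥0 i) (p≤q⇒0≤q-p (F≤b i)))
      (subst (ℚ._≤ 0ℚ) (sym Σslack) (p≤q⇒p-q≤0 b≤ΣwF))

normalised-weights : ∀ {a b c} d⁻¹ → d⁻¹ ℚ.* (a ℚ.+ b ℚ.+ c) ≡ 1ℚ →
  a ℚ.* d⁻¹ ℚ.+ (b ℚ.* d⁻¹ ℚ.+ (c ℚ.* d⁻¹ ℚ.+ 0ℚ)) ≡ 1ℚ
normalised-weights {a} {b} {c} d⁻¹ d⁻¹d≡1 = trans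
  (solve 4 (λ a b c d⁻¹ → a :* d⁻¹ :+ (b :* d⁻¹ :+ (c :* d⁻¹ :+ con 0ℚ)) := d⁻¹ :* (a :+ b :+ c)) refl a b c d⁻¹)
  d⁻¹d≡1
  where open ℚSolver.+-*-Solver

normalised-combination : ∀ {a b c} d⁻¹ → d⁻¹ ℚ.* (a ℚ.+ b ℚ.+ c) ≡ 1ℚ → ∀ {p q r y} →
  (a ℚ.+ b ℚ.+ c) ℚ.* y ≡ a ℚ.* p ℚ.+ b ℚ.* q ℚ.+ c ℚ.* r →
  a ℚ.* d⁻¹ ℚ.* p ℚ.+ (b ℚ.* d⁻¹ ℚ.* q ℚ.+ (c ℚ.* d⁻¹ ℚ.* r ℚ.+ 0ℚ)) ≡ y
normalised-combination {a} {b} {c} d⁻¹ d⁻¹d≡1 {p} {q} {r} {y} dy≡ = begin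
  a ℚ.* d⁻¹ ℚ.* p ℚ.+ (b ℚ.* d⁻¹ ℚ.* q ℚ.+ (c ℚ.* d⁻¹ ℚ.* r ℚ.+ 0ℚ))
    ≡⟨ solve 7 (λ a b c d⁻¹ p q r → a :* d⁻¹ :* p :+ (b :* d⁻¹ :* q :+ (c :* d⁻¹ :* r :+ con 0ℚ))
         := d⁻¹ :* (a :* p :+ b :* q :+ c :* r)) refl a b c d⁻¹ p q r ⟩
  d⁻¹ ℚ.* (a ℚ.* p ℚ.+ b ℚ.* q ℚ.+ c ℚ.* r)  ≡⟨ cong (d⁻¹ ℚ.*_) (sym dy≡) ⟩
  d⁻¹ ℚ.* ((a ℚ.+ b ℚ.+ c) ℚ.* y)            ≡⟨ sym (ℚP.*-assoc d⁻¹ _ y) ⟩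
  d⁻¹ ℚ.* (a ℚ.+ b ℚ.+ c) ℚ.* y              ≡⟨ cong (ℚ._* y) d⁻¹d≡1 ⟩
  1ℚ ℚ.* y                                  ≡⟨ ℚP.*-identityˡ y ⟩
  y                                         ∎
  where
  open ≡-Reasoning
  open ℚSolver.+-*-Solver

-- The lattice ℤ²

ℤ² : Set
ℤ² = ℤ × ℤ

infixr 7 _•_

infixl 6 _+ᵥ_ _-ᵥ_

_∙_ : ℤ² → ℤ² → ℤ
(a₁ , a₂) ∙ (b₁ , b₂) = a₁ ℤ.* b₁ ℤ.+ a₂ ℤ.* b₂

cross : ℤ² → ℤ² → ℤ
cross (a₁ , a₂) (b₁ , b₂) = a₁ ℤ.* b₂ ℤ.- a₂ ℤ.* b₁

_•_ : ℤ → ℤ² → ℤ²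
k • (a₁ , a₂) = k ℤ.* a₁ , k ℤ.* a₂

_+ᵥ_ : ℤ² → ℤ² → ℤ²
(a₁ , a₂) +ᵥ (b₁ , b₂) = a₁ ℤ.+ b₁ , a₂ ℤ.+ b₂

_-ᵥ_ : ℤ² → ℤ² → ℤ²
(a₁ , a₂) -ᵥ (b₁ , b₂) = a₁ ℤ.- b₁ , a₂ ℤ.- b₂

neg : ℤ² → ℤ²
neg (a₁ , a₂) = ℤ.- a₁ , ℤ.- a₂

perp : ℤ² → ℤ²
perp (a₁ , a₂) = ℤ.- a₂ , a₁

mirror : ℤ² → ℤ²
mirror (a₁ , a₂) = a₁ , ℤ.- a₂

_·ℚ_ : ℚ × ℚ → ℤ² → ℚ
(g₁ , g₂) ·ℚ (v₁ , v₂) = g₁ ℚ.* fromℤ v₁ ℚ.+ g₂ ℚ.* fromℤ v₂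

cross-self : ∀ a → cross a a ≡ 0ℤ
cross-self (a₁ , a₂) = solve 2 (λ a₁ a₂ → a₁ :* a₂ :- a₂ :* a₁ := con 0ℤ) refl a₁ a₂
  where open ℤSolver.+-*-Solver

cross-antisym : ∀ a b → cross b a ≡ ℤ.- cross a b
cross-antisym (a₁ , a₂) (b₁ , b₂) =
  solve 4 (λ a₁ a₂ b₁ b₂ → b₁ :* a₂ :- b₂ :* a₁ := :- (a₁ :* b₂ :- a₂ :* b₁)) refl a₁ a₂ b₁ b₂
  where open ℤSolver.+-*-Solver

cross-neg : ∀ a b → cross (neg a) b ≡ ℤ.- cross a b
cross-neg (a₁ , a₂) (b₁ , b₂) =
  solve 4 (λ a₁ a₂ b₁ b₂ → (:- a₁) :* b₂ :- (:- a₂) :* b₁ := :- (a₁ :* b₂ :- a₂ :* b₁)) refl a₁ a₂ b₁ b₂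
  where open ℤSolver.+-*-Solver

cross-mirror : ∀ a b → cross (mirror a) (mirror b) ≡ ℤ.- cross a b
cross-mirror (a₁ , a₂) (b₁ , b₂) =
  solve 4 (λ a₁ a₂ b₁ b₂ → a₁ :* (:- b₂) :- (:- a₂) :* b₁ := :- (a₁ :* b₂ :- a₂ :* b₁)) refl a₁ a₂ b₁ b₂
  where open ℤSolver.+-*-Solver

cross-total : ∀ a b → 0ℤ ℤ.≤ cross a b ⊎ 0ℤ ℤ.≤ cross b a
cross-total a b with ℤP.≤-total 0ℤ (cross a b)
... | inj₁ ab≥0 = inj₁ ab≥0
... | inj₂ ab≤0 = inj₂ (subst (0ℤ ℤ.≤_) (sym (cross-antisym a b)) (ℤP.neg-mono-≤ ab≤0))

cross-zeroʳ : ∀ W → cross W (0ℤ , 0ℤ) ≡ 0ℤ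
cross-zeroʳ (w₁ , w₂) = cong₂ ℤ._-_ (ℤP.*-zeroʳ w₁) (ℤP.*-zeroʳ w₂)

cross-flip : ∀ e u v → cross e (u -ᵥ v) ≡ ℤ.- cross e (v -ᵥ u)
cross-flip (e₁ , e₂) (u₁ , u₂) (v₁ , v₂) = solve 6 (λ e₁ e₂ u₁ u₂ v₁ v₂ →
  e₁ :* (u₂ :- v₂) :- e₂ :* (u₁ :- v₁) := :- (e₁ :* (v₂ :- u₂) :- e₂ :* (v₁ :- u₁)))
  refl e₁ e₂ u₁ u₂ v₁ v₂
  where open ℤSolver.+-*-Solver

fromℤ-cross : ∀ a b →
  fromℤ (cross a b) ≡ fromℤ (proj₁ a) ℚ.* fromℤ (proj₂ b) ℚ.- fromℤ (proj₂ a) ℚ.* fromℤ (proj₁ b)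
fromℤ-cross (a₁ , a₂) (b₁ , b₂) =
  trans (fromℤ-- (a₁ ℤ.* b₂) (a₂ ℤ.* b₁)) (cong₂ ℚ._-_ (fromℤ-* a₁ b₂) (fromℤ-* a₂ b₁))

·ℚ-mirror : ∀ g₁ g₂ v → (g₁ , ℚ.- g₂) ·ℚ mirror v ≡ (g₁ , g₂) ·ℚ v
·ℚ-mirror g₁ g₂ (v₁ , v₂) rewrite fromℤ-neg v₂ =
  solve 4 (λ g₁ g₂ x y → g₁ :* x :+ (:- g₂) :* (:- y) := g₁ :* x :+ g₂ :* y) refl g₁ g₂ (fromℤ v₁) (fromℤ v₂)
  where open ℚSolver.+-*-Solver

·ℚ-zero : ∀ g → g ·ℚ (0ℤ , 0ℤ) ≡ 0ℚ
·ℚ-zero (g₁ , g₂) = trans (cong₂ ℚ._+_ (ℚP.*-zeroʳ g₁) (ℚP.*-zeroʳ g₂)) (ℚP.+-identityʳ 0ℚ)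

-- The counterclockwise order is transitive on the half-plane to the left of W.
cross-trans : ∀ W {a b c} → 0ℤ ℤ.< cross W b → 0ℤ ℤ.≤ cross W a → 0ℤ ℤ.≤ cross W c →
  0ℤ ℤ.≤ cross a b → 0ℤ ℤ.≤ cross b c → 0ℤ ℤ.≤ cross a c
cross-trans W {a} {b} {c} Wb>0 Wa≥0 Wc≥0 ab≥0 bc≥0 =
  ℤ-nonNeg-factor (identity W a b c) Wb>0 (ℤ-*-nonNeg ab≥0 Wc≥0) (ℤ-*-nonNeg bc≥0 Wa≥0)
  where
  open ℤSolver.+-*-Solver
  identity : ∀ W a b c → cross a c ℤ.* cross W b ≡ cross a b ℤ.* cross W c ℤ.+ cross b c ℤ.* cross W a
  identity (w₁ , w₂) (a₁ , a₂) (b₁ , b₂) (c₁ , c₂) = solve 8 (λ w₁ w₂ a₁ a₂ b₁ b₂ c₁ c₂ →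
    (a₁ :* c₂ :- a₂ :* c₁) :* (w₁ :* b₂ :- w₂ :* b₁) :=
    (a₁ :* b₂ :- a₂ :* b₁) :* (w₁ :* c₂ :- w₂ :* c₁) :+ (b₁ :* c₂ :- b₂ :* c₁) :* (w₁ :* a₂ :- w₂ :* a₁))
    refl w₁ w₂ a₁ a₂ b₁ b₂ c₁ c₂

-- Inside the half-plane φ ≤ 0, whose complement contains W, a vector weakly right of W is
-- counterclockwise from any vector strictly left of W.
cross-across : ∀ φ {W r z} → 0ℚ ℚ.< φ ·ℚ W → φ ·ℚ r ℚ.≤ 0ℚ → φ ·ℚ z ℚ.≤ 0ℚ →
  0ℤ ℤ.< cross W r → cross W z ℤ.≤ 0ℤ → 0ℤ ℤ.≤ cross r z
cross-across φ {W} {r} {z} φW>0 φr≤0 φz≤0 Wr>0 Wz≤0 = fromℤ-cancel-≤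
  (ℚ-nonNeg-factor (identity φ W r z) φW>0
    (ℚ-*-nonNeg (fromℤ-mono-≤ (ℤP.<⇒≤ Wr>0)) (ℚP.neg-antimono-≤ φz≤0))
    (ℚ-*-nonNeg (ℚP.neg-antimono-≤ (fromℤ-mono-≤ Wz≤0)) (ℚP.neg-antimono-≤ φr≤0)))
  where
  open ℚSolver.+-*-Solver
  identity : ∀ φ W r z → fromℤ (cross r z) ℚ.* (φ ·ℚ W)
    ≡ fromℤ (cross W r) ℚ.* (ℚ.- (φ ·ℚ z)) ℚ.+ (ℚ.- fromℤ (cross W z)) ℚ.* (ℚ.- (φ ·ℚ r))
  identity (g₁ , g₂) W@(w₁ , w₂) r@(r₁ , r₂) z@(z₁ , z₂)
    rewrite fromℤ-cross r z | fromℤ-cross W r | fromℤ-cross W z = solve 8 (λ g₁ g₂ w₁ w₂ r₁ r₂ z₁ z₂ →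
      (r₁ :* z₂ :- r₂ :* z₁) :* (g₁ :* w₁ :+ g₂ :* w₂) :=
      (w₁ :* r₂ :- w₂ :* r₁) :* (:- (g₁ :* z₁ :+ g₂ :* z₂))
        :+ (:- (w₁ :* z₂ :- w₂ :* z₁)) :* (:- (g₁ :* r₁ :+ g₂ :* r₂)))
      refl g₁ g₂ (fromℤ w₁) (fromℤ w₂) (fromℤ r₁) (fromℤ r₂) (fromℤ z₁) (fromℤ z₂)

parallel-trans : ∀ {W} a b → W ≢ (0ℤ , 0ℤ) → cross W a ≡ 0ℤ → cross W b ≡ 0ℤ → cross a b ≡ 0ℤ
parallel-trans {W@(w₁ , w₂)} a@(a₁ , a₂) b@(b₁ , b₂) W≢0 Wa≡0 Wb≡0
  with ℤP.i*j≡0⇒i≡0∨j≡0 (cross a b) ab·w₁≡0 | ℤP.i*j≡0⇒i≡0∨j≡0 (cross a b) ab·w₂≡0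
  where
  open ℤSolver.+-*-Solver
  ab·w₁≡0 : cross a b ℤ.* w₁ ≡ 0ℤ
  ab·w₁≡0 = trans
    (solve 6 (λ w₁ w₂ a₁ a₂ b₁ b₂ → (a₁ :* b₂ :- a₂ :* b₁) :* w₁ :=
      (w₁ :* b₂ :- w₂ :* b₁) :* a₁ :- (w₁ :* a₂ :- w₂ :* a₁) :* b₁) refl w₁ w₂ a₁ a₂ b₁ b₂)
    (cong₂ (λ s t → s ℤ.* a₁ ℤ.- t ℤ.* b₁) Wb≡0 Wa≡0)
  ab·w₂≡0 : cross a b ℤ.* w₂ ≡ 0ℤ
  ab·w₂≡0 = trans
    (solve 6 (λ w₁ w₂ a₁ a₂ b₁ b₂ → (a₁ :* b₂ :- a₂ :* b₁) :* w₂ :=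
      (w₁ :* b₂ :- w₂ :* b₁) :* a₂ :- (w₁ :* a₂ :- w₂ :* a₁) :* b₂) refl w₁ w₂ a₁ a₂ b₁ b₂)
    (cong₂ (λ s t → s ℤ.* a₂ ℤ.- t ℤ.* b₂) Wb≡0 Wa≡0)
... | inj₁ ab≡0 | _         = ab≡0
... | _         | inj₁ ab≡0 = ab≡0
... | inj₂ w₁≡0 | inj₂ w₂≡0 = ⊥-elim (W≢0 (cong₂ _,_ w₁≡0 w₂≡0))

-- When a ∙ e ≡ 1, the vectors e and perp a form a basis of ℤ², and the coordinates of w -ᵥ u in
-- that basis are a ∙ w - a ∙ u and cross e (w -ᵥ u).
decompose : ∀ {a e} → a ∙ e ≡ 1ℤ → ∀ u w → w ≡ u +ᵥ ((a ∙ w ℤ.- a ∙ u) • e +ᵥ cross e (w -ᵥ u) • perp a)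
decompose {a₁ , a₂} {e₁ , e₂} a∙e≡1 (u₁ , u₂) (w₁ , w₂) = cong₂ _,_
  (begin
    w₁                                                  ≡⟨ unit w₁ u₁ ⟩
    u₁ ℤ.+ (w₁ ℤ.- u₁) ℤ.* 1ℤ                           ≡⟨ cong (λ s → u₁ ℤ.+ (w₁ ℤ.- u₁) ℤ.* s) (sym a∙e≡1) ⟩
    u₁ ℤ.+ (w₁ ℤ.- u₁) ℤ.* (a₁ ℤ.* e₁ ℤ.+ a₂ ℤ.* e₂)     ≡⟨ solve 8 (λ a₁ a₂ e₁ e₂ u₁ u₂ w₁ w₂ →
      u₁ :+ (w₁ :- u₁) :* (a₁ :* e₁ :+ a₂ :* e₂) :=
      u₁ :+ (((a₁ :* w₁ :+ a₂ :* w₂) :- (a₁ :* u₁ :+ a₂ :* u₂)) :* e₁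
             :+ (e₁ :* (w₂ :- u₂) :- e₂ :* (w₁ :- u₁)) :* (:- a₂))) refl a₁ a₂ e₁ e₂ u₁ u₂ w₁ w₂ ⟩
    _ ∎)
  (begin
    w₂                                                  ≡⟨ unit w₂ u₂ ⟩
    u₂ ℤ.+ (w₂ ℤ.- u₂) ℤ.* 1ℤ                           ≡⟨ cong (λ s → u₂ ℤ.+ (w₂ ℤ.- u₂) ℤ.* s) (sym a∙e≡1) ⟩
    u₂ ℤ.+ (w₂ ℤ.- u₂) ℤ.* (a₁ ℤ.* e₁ ℤ.+ a₂ ℤ.* e₂)     ≡⟨ solve 8 (λ a₁ a₂ e₁ e₂ u₁ u₂ w₁ w₂ →
      u₂ :+ (w₂ :- u₂) :* (a₁ :* e₁ :+ a₂ :* e₂) :=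
      u₂ :+ (((a₁ :* w₁ :+ a₂ :* w₂) :- (a₁ :* u₁ :+ a₂ :* u₂)) :* e₂
             :+ (e₁ :* (w₂ :- u₂) :- e₂ :* (w₁ :- u₁)) :* a₁)) refl a₁ a₂ e₁ e₂ u₁ u₂ w₁ w₂ ⟩
    _ ∎)
  where
  open ≡-Reasoning
  open ℤSolver.+-*-Solver
  unit : ∀ w u → w ≡ u ℤ.+ (w ℤ.- u) ℤ.* 1ℤ
  unit = solve 2 (λ w u → w := u :+ (w :- u) :* con 1ℤ) refl

∙-along-perp : ∀ a u e s → a ∙ (u +ᵥ e +ᵥ s • perp a) ≡ a ∙ u ℤ.+ a ∙ e
∙-along-perp (a₁ , a₂) (u₁ , u₂) (e₁ , e₂) s = solve 7 (λ a₁ a₂ u₁ u₂ e₁ e₂ s →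
  a₁ :* (u₁ :+ e₁ :+ s :* (:- a₂)) :+ a₂ :* (u₂ :+ e₂ :+ s :* a₁)
    := (a₁ :* u₁ :+ a₂ :* u₂) :+ (a₁ :* e₁ :+ a₂ :* e₂))
  refl a₁ a₂ u₁ u₂ e₁ e₂ s
  where open ℤSolver.+-*-Solver

primitive-part : ∀ d → d ≢ (0ℤ , 0ℤ) →
  Σ ℤ λ G → 0ℤ ℤ.< G × Σ ℤ² λ d′ → Coprime ∣ proj₁ d′ ∣ ∣ proj₂ d′ ∣ × d ≡ G • d′
primitive-part (d₁ , d₂) d≢0 =
  + g , ℤ.+<+ (ℕP.n≢0⇒n>0 g≢0) , (divide d₁ , divide d₂) ,
  subst₂ Coprime (sym (ℤP.abs-◃ _ _)) (sym (ℤP.abs-◃ _ _)) (coprime-/gcd ∣ d₁ ∣ ∣ d₂ ∣) ,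
  cong₂ _,_ (rescale d₁ (gcd[m,n]∣m ∣ d₁ ∣ ∣ d₂ ∣)) (rescale d₂ (gcd[m,n]∣n ∣ d₁ ∣ ∣ d₂ ∣))
  where
  g : ℕ
  g = gcd ∣ d₁ ∣ ∣ d₂ ∣
  g≢0 : g ≢ 0
  g≢0 g≡0 = d≢0 (cong₂ _,_ (ℤP.∣i∣≡0⇒i≡0 (gcd[m,n]≡0⇒m≡0 g≡0))
                            (ℤP.∣i∣≡0⇒i≡0 (gcd[m,n]≡0⇒n≡0 ∣ d₁ ∣ g≡0)))
  instance
    g-nonZero : ℕ.NonZero g
    g-nonZero = ℕ.≢-nonZero g≢0
  divide : ℤ → ℤ
  divide i = ℤ.sign i ◃ (∣ i ∣ ℕ./ g)
  rescale : ∀ i → g ∣ℕ ∣ i ∣ → i ≡ + g ℤ.* divide i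
  rescale i g∣i = begin
    i                                 ≡⟨ sym (ℤP.◃-inverse i) ⟩
    ℤ.sign i ◃ ∣ i ∣                   ≡⟨ cong (ℤ.sign i ◃_) (trans (sym (m/n*n≡m g∣i)) (ℕP.*-comm _ g)) ⟩
    ℤ.sign i ◃ (g ℕ.* (∣ i ∣ ℕ./ g))   ≡⟨ ℤP.◃-distrib-* Sign.+ (ℤ.sign i) g _ ⟩
    (Sign.+ ◃ g) ℤ.* divide i         ≡⟨ cong (ℤ._* divide i) (ℤP.+◃n≡+n g) ⟩
    + g ℤ.* divide i                  ∎
    where open ≡-Reasoning

times-sign : ∀ i m → i ℤ.* (ℤ.sign i ◃ m) ≡ + (∣ i ∣ ℕ.* m)
times-sign i m = begin
  i ℤ.* (ℤ.sign i ◃ m)                         ≡⟨ cong (ℤ._* (ℤ.sign i ◃ m)) (sym (ℤP.◃-inverse i)) ⟩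
  (ℤ.sign i ◃ ∣ i ∣) ℤ.* (ℤ.sign i ◃ m)         ≡⟨ sym (ℤP.◃-distrib-* (ℤ.sign i) (ℤ.sign i) ∣ i ∣ m) ⟩
  (ℤ.sign i Sign.* ℤ.sign i) ◃ (∣ i ∣ ℕ.* m)   ≡⟨ cong (_◃ (∣ i ∣ ℕ.* m)) (SignP.s*s≡+ (ℤ.sign i)) ⟩
  Sign.+ ◃ (∣ i ∣ ℕ.* m)                       ≡⟨ ℤP.+◃n≡+n _ ⟩
  + (∣ i ∣ ℕ.* m)                              ∎
  where open ≡-Reasoning

bezout-combination : ∀ i j x y → 1 ℕ.+ y ℕ.* ∣ j ∣ ≡ x ℕ.* ∣ i ∣ →
  i ℤ.* (ℤ.sign i ◃ x) ℤ.+ j ℤ.* ℤ.- (ℤ.sign j ◃ y) ≡ 1ℤ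
bezout-combination i j x y eq = begin
  i ℤ.* (ℤ.sign i ◃ x) ℤ.+ j ℤ.* ℤ.- (ℤ.sign j ◃ y)
    ≡⟨ cong₂ ℤ._+_ (times-sign i x) (trans (sym (ℤP.neg-distribʳ-* j _)) (cong ℤ.-_ (times-sign j y))) ⟩
  + (∣ i ∣ ℕ.* x) ℤ.- + (∣ j ∣ ℕ.* y)
    ≡⟨ cong (λ m → + m ℤ.- + (∣ j ∣ ℕ.* y)) (trans (ℕP.*-comm ∣ i ∣ x) (sym eq′)) ⟩
  + (1 ℕ.+ ∣ j ∣ ℕ.* y) ℤ.- + (∣ j ∣ ℕ.* y)
    ≡⟨ solve 1 (λ m → (con 1ℤ :+ m) :- m := con 1ℤ) refl (+ (∣ j ∣ ℕ.* y)) ⟩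
  1ℤ ∎
  where
  open ≡-Reasoning
  open ℤSolver.+-*-Solver
  eq′ : 1 ℕ.+ ∣ j ∣ ℕ.* y ≡ x ℕ.* ∣ i ∣
  eq′ = trans (cong (1 ℕ.+_) (ℕP.*-comm ∣ j ∣ y)) eq

bezout : ∀ a → Coprime ∣ proj₁ a ∣ ∣ proj₂ a ∣ → Σ ℤ² λ e → a ∙ e ≡ 1ℤ
bezout (a₁ , a₂) coprime with Coprimality.coprime-Bézout coprime
... | Bézout.+- x y eq = (ℤ.sign a₁ ◃ x , ℤ.- (ℤ.sign a₂ ◃ y)) , bezout-combination a₁ a₂ x y eq
... | Bézout.-+ x y eq = (ℤ.- (ℤ.sign a₁ ◃ x) , ℤ.sign a₂ ◃ y) ,
  trans (ℤP.+-comm (a₁ ℤ.* ℤ.- (ℤ.sign a₁ ◃ x)) (a₂ ℤ.* (ℤ.sign a₂ ◃ y))) (bezout-combination a₂ a₁ y x eq)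

-- lin a₁ a₂ p is (a₁ , a₂) ∙ pos p by definition.
pos : ∀ {n} → E n → ℤ²
pos p = x₁ℤ p , x₂ℤ p

pos-injective : ∀ {n} {p q : E n} → pos p ≡ pos q → p ≡ q
pos-injective p≡q = cong₂ _,_ (FinP.toℕ-injective (ℤP.+-injective (cong proj₁ p≡q)))
                              (FinP.toℕ-injective (ℤP.+-injective (cong proj₂ p≡q)))

_⟶_ : ∀ {n} → E n → E n → ℤ²
p ⟶ q = x₁ℤ q ℤ.- x₁ℤ p , x₂ℤ q ℤ.- x₂ℤ p

⟶-self : ∀ {n} (p : E n) → p ⟶ p ≡ (0ℤ , 0ℤ)
⟶-self p = cong₂ _,_ (ℤP.+-inverseʳ (x₁ℤ p)) (ℤP.+-inverseʳ (x₂ℤ p))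

⟶-distinct : ∀ {n} {u r : E n} (h : ℤ² → ℤ) → h (0ℤ , 0ℤ) ≡ 0ℤ → 0ℤ ℤ.< h (u ⟶ r) → r ≢ u
⟶-distinct {u = u} h h0≡0 h>0 refl = ℤP.<-irrefl (sym (trans (cong h (⟶-self u)) h0≡0)) h>0

cross-⟶ : ∀ {n} W (u p q : E n) → cross W (p ⟶ q) ≡ cross W (u ⟶ q) ℤ.- cross W (u ⟶ p)
cross-⟶ (w₁ , w₂) u p q = solve 8 (λ w₁ w₂ u₁ u₂ p₁ p₂ q₁ q₂ →
  w₁ :* (q₂ :- p₂) :- w₂ :* (q₁ :- p₁)
    := (w₁ :* (q₂ :- u₂) :- w₂ :* (q₁ :- u₁)) :- (w₁ :* (p₂ :- u₂) :- w₂ :* (p₁ :- u₁)))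
  refl w₁ w₂ (x₁ℤ u) (x₂ℤ u) (x₁ℤ p) (x₂ℤ p) (x₁ℤ q) (x₂ℤ q)
  where open ℤSolver.+-*-Solver

linℚ : ∀ {n} → ℚ → ℚ → E n → ℚ
linℚ a₁ a₂ p = a₁ ℚ.* x₁ℚ p ℚ.+ a₂ ℚ.* x₂ℚ p

·ℚ-⟶ : ∀ {n} g₁ g₂ (u p : E n) → (g₁ , g₂) ·ℚ (u ⟶ p) ≡ linℚ g₁ g₂ p ℚ.- linℚ g₁ g₂ u
·ℚ-⟶ g₁ g₂ u p rewrite fromℤ-- (x₁ℤ p) (x₁ℤ u) | fromℤ-- (x₂ℤ p) (x₂ℤ u) =
  solve 6 (λ g₁ g₂ p₁ p₂ u₁ u₂ → g₁ :* (p₁ :- u₁) :+ g₂ :* (p₂ :- u₂)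
                                 := (g₁ :* p₁ :+ g₂ :* p₂) :- (g₁ :* u₁ :+ g₂ :* u₂))
    refl g₁ g₂ (x₁ℚ p) (x₂ℚ p) (x₁ℚ u) (x₂ℚ u)
  where open ℚSolver.+-*-Solver

fromℤ-lin : ∀ {n} a₁ a₂ (p : E n) → fromℤ (lin a₁ a₂ p) ≡ linℚ (fromℤ a₁) (fromℤ a₂) p
fromℤ-lin a₁ a₂ p =
  trans (fromℤ-+ (a₁ ℤ.* x₁ℤ p) (a₂ ℤ.* x₂ℤ p))
        (cong₂ ℚ._+_ (fromℤ-* a₁ (x₁ℤ p)) (fromℤ-* a₂ (x₂ℤ p)))

linℚ-combination : ∀ {n} k (w : Fin k → ℚ) (q : Fin k → E n) {y : E n} a₁ a₂ →
  Σℚ k (λ i → w i ℚ.* x₁ℚ (q i)) ≡ x₁ℚ y → Σℚ k (λ i → w i ℚ.* x₂ℚ (q i)) ≡ x₂ℚ y →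
  Σℚ k (λ i → w i ℚ.* linℚ a₁ a₂ (q i)) ≡ linℚ a₁ a₂ y
linℚ-combination k w q a₁ a₂ Σx₁≡ Σx₂≡ =
  trans (Σℚ-linear k w _ _ a₁ a₂) (cong₂ (λ s t → a₁ ℚ.* s ℚ.+ a₂ ℚ.* t) Σx₁≡ Σx₂≡)

InP⇒M₁ : ∀ {n} {f : BFun n} → InT2 n f → ∀ {y} → InP f y → M f true y
InP⇒M₁ (_ , a , defines) {y} (k , w , q , w≥0 , q∈M₁ , Σw≡1 , Σx₁≡ , Σx₂≡) =
  proj₂ (defines y) λ j → holds (a j) (λ i → proj₁ (defines (q i)) (q∈M₁ i) j)
  where
  holds : ∀ c → (∀ i → satisfies c (q i)) → satisfies c y
  holds (c₁ , c₂ , c₀) c-holds = subst (ℚ._≤ c₀) (linℚ-combination k w q {y} c₁ c₂ Σx₁≡ Σx₂≡)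
    (Average.≤-bound w≥0 Σw≡1 c-holds)

E-≡ : ∀ {n} {p q : E n} → x₁ℚ p ≡ x₁ℚ q → x₂ℚ p ≡ x₂ℚ q → p ≡ q
E-≡ p₁≡q₁ p₂≡q₂ = pos-injective (cong₂ _,_ (fromℤ-injective p₁≡q₁) (fromℤ-injective p₂≡q₂))

module _ {n : ℕ} (f : BFun n) where

  M₁-list : List (E n)
  M₁-list = filter (λ p → f p Bool.≟ true) (cartesianProduct (allFin n) (allFin n))

  ∈M₁-list⁺ : ∀ {p} → M f true p → p ∈ M₁-list
  ∈M₁-list⁺ {i , j} = ∈-filter⁺ (λ p → f p Bool.≟ true) (∈-cartesianProduct⁺ (∈-allFin {n = n} i) (∈-allFin j))

  ∈M₁-list⁻ : ∀ {p} → p ∈ M₁-list → M f true p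
  ∈M₁-list⁻ p∈ = proj₂ (∈-filter⁻ (λ p → f p Bool.≟ true) {xs = cartesianProduct (allFin n) (allFin n)} p∈)

-- Separating a point of M₀(f) by an edge of P(f)

Least : {A : Set} → (A → Set) → (A → A → Set) → List A → Set
Least {A} P _≼_ L = (∀ {a} → a ∈ L → ¬ P a) ⊎ Σ A λ r → r ∈ L × P r × (∀ {b} → b ∈ L → P b → r ≼ b)

module _ {A : Set} {P : A → Set} (P? : Decidable P) (_≼_ : A → A → Set)
  (≼-refl : ∀ a → a ≼ a)
  (≼-total : ∀ {a b} → P a → P b → a ≼ b ⊎ b ≼ a)
  (≼-trans : ∀ {a b c} → P a → P b → P c → a ≼ b → b ≼ c → a ≼ c) where

  least-among : (L : List A) → Least P _≼_ L
  least-among [] = inj₁ λ ()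
  least-among (a ∷ L) with P? a | least-among L
  ... | no ¬Pa | inj₁ none = inj₁ λ { (here refl) → ¬Pa ; (there b∈L) → none b∈L }
  ... | no ¬Pa | inj₂ (r , r∈L , Pr , r-least) =
    inj₂ (r , there r∈L , Pr , λ { (here refl) Pa → ⊥-elim (¬Pa Pa) ; (there b∈L) → r-least b∈L })
  ... | yes Pa | inj₁ none =
    inj₂ (a , here refl , Pa , λ { (here refl) _ → ≼-refl a ; (there b∈L) Pb → ⊥-elim (none b∈L Pb) })
  ... | yes Pa | inj₂ (r , r∈L , Pr , r-least) with ≼-total Pa Pr
  ...   | inj₁ a≼r = inj₂ (a , here refl , Pa ,
          λ { (here refl) _ → ≼-refl a ; (there b∈L) Pb → ≼-trans Pa Pr Pb a≼r (r-least b∈L Pb) })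
  ...   | inj₂ r≼a = inj₂ (r , there r∈L , Pr , λ { (here refl) _ → r≼a ; (there b∈L) → r-least b∈L })

LeftExtreme : {A : Set} → (A → ℤ²) → ℤ² → List A → Set
LeftExtreme {A} z W L = (∀ {a} → a ∈ L → cross W (z a) ℤ.≤ 0ℤ)
  ⊎ Σ A λ r → r ∈ L × 0ℤ ℤ.< cross W (z r) × (∀ {b} → b ∈ L → 0ℤ ℤ.≤ cross (z r) (z b))

left-extreme : ∀ {A} (z : A → ℤ²) {W} φ → 0ℚ ℚ.< φ ·ℚ W →
  (L : List A) → (∀ {a} → a ∈ L → φ ·ℚ z a ℚ.≤ 0ℚ) → LeftExtreme z W L
left-extreme z {W} φ φW>0 L φ≤0 = extend (least-among (λ a → 0ℤ ℤ.<? cross W (z a)) (λ a b → 0ℤ ℤ.≤ cross (z a) (z b))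
  (λ a → ℤP.≤-reflexive (sym (cross-self (z a))))
  (λ {a} {b} _ _ → cross-total (z a) (z b))
  (λ {a} {b} {c} Wa>0 Wb>0 Wc>0 → cross-trans W {z a} {z b} {z c} Wb>0 (ℤP.<⇒≤ Wa>0) (ℤP.<⇒≤ Wc>0))
  L)
  where
  extend : Least (λ a → 0ℤ ℤ.< cross W (z a)) (λ a b → 0ℤ ℤ.≤ cross (z a) (z b)) L → LeftExtreme z W L
  extend (inj₁ none-left) = inj₁ (λ a∈L → ℤP.≮⇒≥ (none-left a∈L))
  extend (inj₂ (r , r∈L , Wr>0 , r-least)) = inj₂ (r , r∈L , Wr>0 , r-extreme)
    where
    r-extreme : ∀ {b} → b ∈ L → 0ℤ ℤ.≤ cross (z r) (z b)
    r-extreme {b} b∈L with 0ℤ ℤ.<? cross W (z b)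
    ... | yes Wb>0 = r-least b∈L Wb>0
    ... | no  Wb≯0 = cross-across φ {W} {z r} {z b} φW>0 (φ≤0 r∈L) (φ≤0 b∈L) Wr>0 (ℤP.≮⇒≥ Wb≯0)

not-all-parallel : ∀ {n} {f : BFun n} → PositiveArea f → ∀ {W} → W ≢ (0ℤ , 0ℤ) → ∀ u →
  ¬ (∀ p → M f true p → cross W (u ⟶ p) ≡ 0ℤ)
not-all-parallel {f = f} (P , Q , R , P∈M₁ , Q∈M₁ , R∈M₁ , PQR-noncollinear) {W} W≢0 u all-parallel =
  PQR-noncollinear (ℤP.i-j≡0⇒i≡j _ _ (parallel-trans (P ⟶ Q) (P ⟶ R) W≢0 (parallel Q∈M₁) (parallel R∈M₁)))
  where
  parallel : ∀ {q} → M f true q → cross W (P ⟶ q) ≡ 0ℤ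
  parallel {q} q∈M₁ = trans (cross-⟶ W u P q)
    (cong₂ ℤ._-_ (all-parallel q q∈M₁) (all-parallel P P∈M₁))

ViolatedEdge : ∀ {n} → BFun n → E n → Set
ViolatedEdge f y = Σ ℤ λ a₁ → Σ ℤ λ a₂ → Σ ℤ λ a₀ → EdgeIneq f a₁ a₂ a₀ × a₀ ℤ.< lin a₁ a₂ y

record SupportingDirection {n} (f : BFun n) (u y : E n) (δ : ℤ²) : Set where
  field
    r         : E n
    r≢u       : r ≢ u
    r∈M₁      : M f true r
    on-line   : cross δ (u ⟶ r) ≡ 0ℤ
    supports  : ∀ p → M f true p → 0ℤ ℤ.≤ cross δ (u ⟶ p)
    separates : cross δ (u ⟶ y) ℤ.< 0ℤ

supporting⇒violatedEdge : ∀ {n} {f : BFun n} {u y δ} → M f true u → SupportingDirection f u y δ → ViolatedEdge f y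
supporting⇒violatedEdge {n} {f} {u} {y} {δ} u∈M₁ S = edge (primitive-part δ δ≢0)
  where
  open SupportingDirection S
  δ≢0 : δ ≢ (0ℤ , 0ℤ)
  δ≢0 refl = ℤP.<-irrefl refl separates
  edge : (Σ ℤ λ G → 0ℤ ℤ.< G × Σ ℤ² λ d → Coprime ∣ proj₁ d ∣ ∣ proj₂ d ∣ × δ ≡ G • d) →
    ViolatedEdge f y
  edge (G , G>0 , (d₁ , d₂) , coprime , δ≡Gd) =
    d₂ , ℤ.- d₁ , L u ,
    (coprime′ , valid , u , r , (λ u≡r → r≢u (sym u≡r)) , u∈M₁ , r∈M₁ , refl , r-on-edge) , beyond
    where
    instance
      G-nonZero : ℤ.NonZero G
      G-nonZero = ℤ.>-nonZero G>0
      G-positive : ℤ.Positive G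
      G-positive = ℤ.positive G>0
      G-nonNeg : ℤ.NonNegative G
      G-nonNeg = ℤ.nonNegative (ℤP.<⇒≤ G>0)
    L : E n → ℤ
    L = lin d₂ (ℤ.- d₁)
    scaled : ∀ p → cross δ (u ⟶ p) ≡ G ℤ.* (L u ℤ.- L p)
    scaled p = trans (cong (λ v → cross v (u ⟶ p)) δ≡Gd)
      (solve 7 (λ G d₁ d₂ u₁ u₂ p₁ p₂ → (G :* d₁) :* (p₂ :- u₂) :- (G :* d₂) :* (p₁ :- u₁) :=
        G :* ((d₂ :* u₁ :+ (:- d₁) :* u₂) :- (d₂ :* p₁ :+ (:- d₁) :* p₂)))
        refl G d₁ d₂ (x₁ℤ u) (x₂ℤ u) (x₁ℤ p) (x₂ℤ p))
      where open ℤSolver.+-*-Solver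
    coprime′ : Coprime ∣ d₂ ∣ ∣ ℤ.- d₁ ∣
    coprime′ = subst (Coprime ∣ d₂ ∣) (sym (ℤP.∣-i∣≡∣i∣ d₁)) (Coprimality.sym coprime)
    valid : ∀ p → M f true p → L p ℤ.≤ L u
    valid p p∈M₁ = ℤP.0≤i-j⇒j≤i (ℤP.*-cancelˡ-≤-pos 0ℤ _ G
      (subst₂ ℤ._≤_ (sym (ℤP.*-zeroʳ G)) (scaled p) (supports p p∈M₁)))
    r-on-edge : L r ≡ L u
    r-on-edge = sym (ℤP.i-j≡0⇒i≡j _ _ (ℤP.*-cancelˡ-≡ G _ 0ℤ
      (trans (sym (scaled r)) (trans on-line (sym (ℤP.*-zeroʳ G))))))
    beyond : L u ℤ.< L y
    beyond = i-j<0⇒i<j (ℤP.*-cancelˡ-<-nonNeg G (subst₂ ℤ._<_ (scaled y) (sym (ℤP.*-zeroʳ G)) separates))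

module _ {n} {f : BFun n} (area : PositiveArea f) {u y : E n} (φ₁ φ₂ : ℚ)
  (φW>0 : 0ℚ ℚ.< (φ₁ , φ₂) ·ℚ (u ⟶ y)) (φ≤0 : ∀ p → M f true p → (φ₁ , φ₂) ·ℚ (u ⟶ p) ℚ.≤ 0ℚ) where

  private
    W : ℤ²
    W = u ⟶ y
    φ̄W>0 : 0ℚ ℚ.< (φ₁ , ℚ.- φ₂) ·ℚ mirror W
    φ̄W>0 = subst (0ℚ ℚ.<_) (sym (·ℚ-mirror φ₁ φ₂ W)) φW>0

  -- Reflection reverses orientation, so the second search finds the extreme point to the right of W.
  -- If neither side of the line through u and y contains a point of M₁(f), then M₁(f) is collinear.
  supportingDirection : Σ ℤ² (SupportingDirection f u y)
  supportingDirection = combine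
    (left-extreme (u ⟶_) {W} (φ₁ , φ₂) φW>0 (M₁-list f) (λ p∈ → φ≤0 _ (∈M₁-list⁻ f p∈)))
    (left-extreme (mirror ∘ (u ⟶_)) {mirror W} (φ₁ , ℚ.- φ₂) φ̄W>0 (M₁-list f)
      (λ {p} p∈ → subst (ℚ._≤ 0ℚ) (sym (·ℚ-mirror φ₁ φ₂ (u ⟶ p))) (φ≤0 p (∈M₁-list⁻ f p∈))))
    where
    combine : LeftExtreme (u ⟶_) W (M₁-list f) → LeftExtreme (mirror ∘ (u ⟶_)) (mirror W) (M₁-list f) →
      Σ ℤ² (SupportingDirection f u y)
    combine (inj₂ (r , r∈ , Wr>0 , r-extreme)) _ = u ⟶ r , record
      { r         = r
      ; r≢u       = ⟶-distinct (cross W) (cross-zeroʳ W) Wr>0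
      ; r∈M₁      = ∈M₁-list⁻ f r∈
      ; on-line   = cross-self (u ⟶ r)
      ; supports  = λ p p∈M₁ → r-extreme (∈M₁-list⁺ f p∈M₁)
      ; separates = subst (ℤ._< 0ℤ) (sym (cross-antisym W (u ⟶ r))) (ℤP.neg-mono-< Wr>0)
      }
    combine (inj₁ _) (inj₂ (r , r∈ , W̄r>0 , r-extreme)) = neg (u ⟶ r) , record
      { r         = r
      ; r≢u       = ⟶-distinct (λ v → cross (mirror W) (mirror v)) (cross-zeroʳ (mirror W)) W̄r>0
      ; r∈M₁      = ∈M₁-list⁻ f r∈
      ; on-line   = trans (cross-neg (u ⟶ r) (u ⟶ r)) (cong ℤ.-_ (cross-self (u ⟶ r)))
      ; supports  = λ p p∈M₁ → subst (0ℤ ℤ.≤_)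
          (trans (cross-mirror (u ⟶ r) (u ⟶ p)) (sym (cross-neg (u ⟶ r) (u ⟶ p))))
          (r-extreme (∈M₁-list⁺ f p∈M₁))
      ; separates = subst (ℤ._< 0ℤ)
          (sym (trans (cross-neg (u ⟶ r) W) (cong ℤ.-_ (trans (cross-antisym W (u ⟶ r)) (sym (cross-mirror W (u ⟶ r)))))))
          (ℤP.neg-mono-< W̄r>0)
      }
    combine (inj₁ none-left) (inj₁ none-right) = ⊥-elim (not-all-parallel area W≢0 u all-parallel)
      where
      W≢0 : W ≢ (0ℤ , 0ℤ)
      W≢0 W≡0 = ℚP.<-irrefl (sym (trans (cong ((φ₁ , φ₂) ·ℚ_) W≡0) (·ℚ-zero (φ₁ , φ₂)))) φW>0
      all-parallel : ∀ p → M f true p → cross W (u ⟶ p) ≡ 0ℤ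
      all-parallel p p∈M₁ = ℤP.≤-antisym (none-left p∈) (subst (0ℤ ℤ.≤_) (ℤP.neg-involutive _)
        (ℤP.neg-mono-≤ (subst (ℤ._≤ 0ℤ) (cross-mirror W (u ⟶ p)) (none-right p∈))))
        where p∈ = ∈M₁-list⁺ f p∈M₁

ineq⇒violatedEdge : ∀ {n} {f : BFun n} → PositiveArea f → ∀ {y} (c : Ineq) →
  (∀ p → M f true p → satisfies c p) → ¬ satisfies c y → ViolatedEdge f y
ineq⇒violatedEdge {n} {f} area@(P , _ , _ , P∈M₁ , _) {y} (c₁ , c₂ , c₀) c-valid c-fails =
  supporting⇒violatedEdge u∈M₁ (proj₂ (supportingDirection area c₁ c₂ φW>0 φ≤0))
  where
  C : E n → ℚ
  C = linℚ c₁ c₂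
  u : E n
  u = ℚExtrema.argmax C P (M₁-list f)
  u∈M₁ : M f true u
  u∈M₁ = ℚExtrema.argmax-all C P∈M₁ (All.tabulate (∈M₁-list⁻ f))
  φW>0 : 0ℚ ℚ.< (c₁ , c₂) ·ℚ (u ⟶ y)
  φW>0 = subst (0ℚ ℚ.<_) (sym (·ℚ-⟶ c₁ c₂ u y)) (p<q⇒0<q-p (ℚP.≤-<-trans (c-valid u u∈M₁) (ℚP.≰⇒> c-fails)))
  φ≤0 : ∀ p → M f true p → (c₁ , c₂) ·ℚ (u ⟶ p) ℚ.≤ 0ℚ
  φ≤0 p p∈M₁ = subst (ℚ._≤ 0ℚ) (sym (·ℚ-⟶ c₁ c₂ u p))
    (p≤q⇒p-q≤0 (All.lookup (ℚExtrema.f[xs]≤f[argmax] {f = C} P (M₁-list f)) (∈M₁-list⁺ f p∈M₁)))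

M₀⇒violatedEdge : ∀ {n} {f : BFun n} → InT2 n f → PositiveArea f → ∀ {y} → M f false y → ViolatedEdge f y
M₀⇒violatedEdge {f = f} (k , a , defines) area {y} fy≡false
  with FinP.¬∀⟶∃¬ k (λ i → satisfies (a i) y) (λ i → satisfies? (a i))
         (λ all-hold → BoolP.not-¬ (proj₂ (defines y) all-hold) fy≡false)
  where
  satisfies? : ∀ c → Dec (satisfies c y)
  satisfies? (c₁ , c₂ , c₀) = linℚ c₁ c₂ y ℚ.≤? c₀
... | i , fails = ineq⇒violatedEdge area (a i) (λ p p∈M₁ → proj₁ (defines p) p∈M₁ i) fails

-- ΔP(f) ∩ M₀(f) ⊆ D(f)

ΔP∩M₀⊆D : ∀ {n} {f : BFun n} → InT2 n f → PositiveArea f → ∀ x → InP' f x → M f false x → InD f x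
ΔP∩M₀⊆D {n} {f} T area x x∈P' fx≡false =
  fx≡false , λ y fy≡false y∈conv → isolated y y∈conv (M₀⇒violatedEdge T area fy≡false)
  where
  isolated : ∀ y → InConv (λ q → M f true q ⊎ q ≡ x) y → ViolatedEdge f y → y ≡ x
  isolated y (k , w , q , w≥0 , q∈ , Σw≡1 , Σx₁≡ , Σx₂≡) (a₁ , a₂ , a₀ , edge@(_ , valid , _) , beyond) =
    E-≡ (trans (sym Σx₁≡) (Average.concentrated w≥0 Σw≡1 (λ i → Data.Sum.map₂ (cong x₁ℚ) (at-x i (q∈ i)))))
        (trans (sym Σx₂≡) (Average.concentrated w≥0 Σw≡1 (λ i → Data.Sum.map₂ (cong x₂ℚ) (at-x i (q∈ i)))))
    where
    L : E n → ℚ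
    L = linℚ (fromℤ a₁) (fromℤ a₂)
    b : ℚ
    b = fromℤ (a₀ ℤ.+ 1ℤ)
    below-edge : ∀ {p} → M f true p → L p ℚ.< b
    below-edge {p} p∈M₁ = ℚP.≤-<-trans
      (subst (ℚ._≤ fromℤ a₀) (fromℤ-lin a₁ a₂ p) (fromℤ-mono-≤ (valid p p∈M₁))) (fromℤ-mono-< (i<i+1 a₀))
    L≤b : ∀ {p} → M f true p ⊎ p ≡ x → L p ℚ.≤ b
    L≤b (inj₁ p∈M₁) = ℚP.<⇒≤ (below-edge p∈M₁)
    L≤b (inj₂ refl) = subst (ℚ._≤ b) (fromℤ-lin a₁ a₂ x) (fromℤ-mono-≤ (x∈P' a₁ a₂ a₀ edge))
    b≤ΣwL : b ℚ.≤ Σℚ k (λ i → w i ℚ.* L (q i))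
    b≤ΣwL = subst (b ℚ.≤_)
      (trans (fromℤ-lin a₁ a₂ y) (sym (linℚ-combination k w q {y} (fromℤ a₁) (fromℤ a₂) Σx₁≡ Σx₂≡)))
      (fromℤ-mono-≤ (i<j⇒i+1≤j beyond))
    at-x : ∀ i → M f true (q i) ⊎ q i ≡ x → w i ≡ 0ℚ ⊎ q i ≡ x
    at-x i (inj₁ qᵢ∈M₁) =
      inj₁ (Average.no-weight-below-max w≥0 Σw≡1 (λ j → L≤b (q∈ j)) b≤ΣwL i (below-edge qᵢ∈M₁))
    at-x i (inj₂ qᵢ≡x)  = inj₂ qᵢ≡x

-- Lattice points in triangles and D(f) ⊆ ΔP(f) ∩ M₀(f)

record InTriangle (u v x Y : ℤ²) : Set where
  field
    α β γ      : ℤ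
    α≥0        : 0ℤ ℤ.≤ α
    β≥0        : 0ℤ ℤ.≤ β
    γ≥0        : 0ℤ ℤ.≤ γ
    barycentre : (α ℤ.+ β ℤ.+ γ) • Y ≡ α • u +ᵥ β • v +ᵥ γ • x
    total>0    : 0ℤ ℤ.< α ℤ.+ β ℤ.+ γ

InTriangle-swap : ∀ {u v x Y} → InTriangle u v x Y → InTriangle v u x Y
InTriangle-swap {u} {v} {x} {Y} T = record
  { α = β ; β = α ; γ = γ ; α≥0 = β≥0 ; β≥0 = α≥0 ; γ≥0 = γ≥0
  ; barycentre = trans (cong (_• Y) (swap-sum α β γ)) (trans barycentre (swap-combination u v x))
  ; total>0 = subst (0ℤ ℤ.<_) (swap-sum β α γ) total>0
  }
  where
  open InTriangle T
  open ℤSolver.+-*-Solver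
  swap-sum : ∀ a b c → b ℤ.+ a ℤ.+ c ≡ a ℤ.+ b ℤ.+ c
  swap-sum = solve 3 (λ a b c → b :+ a :+ c := a :+ b :+ c) refl
  swap-combination : ∀ u v x → α • u +ᵥ β • v +ᵥ γ • x ≡ β • v +ᵥ α • u +ᵥ γ • x
  swap-combination (u₁ , u₂) (v₁ , v₂) (x₁ , x₂) = cong₂ _,_ (swap u₁ v₁ x₁) (swap u₂ v₂ x₂)
    where
    swap : ∀ p q r → α ℤ.* p ℤ.+ β ℤ.* q ℤ.+ γ ℤ.* r ≡ β ℤ.* q ℤ.+ α ℤ.* p ℤ.+ γ ℤ.* r
    swap = solve 6 (λ a b c p q r → a :* p :+ b :* q :+ c :* r := b :* q :+ a :* p :+ c :* r) refl α β γ

-- With H = 1 + h, v = u + m·perp a and x = u + H·e - (ρ + t H)·perp a, the point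
-- Y = u + e - t·perp a satisfies H m Y = (h m - ρ) u + ρ v + m x, a convex combination once 0 ≤ ρ ≤ h.
lattice-core : ∀ (a e u : ℤ²) (h ρ : ℕ) (t m : ℤ) → ρ ℕ.≤ h → 0ℤ ℤ.< m →
  InTriangle u (u +ᵥ (0ℤ • e +ᵥ m • perp a))
               (u +ᵥ (+ suc h • e +ᵥ ℤ.- (+ ρ ℤ.+ t ℤ.* + suc h) • perp a))
               (u +ᵥ e +ᵥ ℤ.- t • perp a)
lattice-core (a₁ , a₂) (e₁ , e₂) (u₁ , u₂) h ρ t m ρ≤h m>0 = record
  { α = + h ℤ.* m ℤ.- + ρ
  ; β = + ρ
  ; γ = m
  ; α≥0 = ℤP.i≤j⇒0≤j-i (ℤP.≤-trans (ℤ.+≤+ ρ≤h) h≤hm)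
  ; β≥0 = ℤ.+≤+ z≤n
  ; γ≥0 = ℤP.<⇒≤ m>0
  ; barycentre = cong₂ _,_ (identity (+ h) (+ ρ) t m u₁ e₁ (ℤ.- a₂)) (identity (+ h) (+ ρ) t m u₂ e₂ a₁)
  ; total>0 = ℤP.+-mono-≤-< (ℤP.+-mono-≤ (ℤP.i≤j⇒0≤j-i (ℤP.≤-trans (ℤ.+≤+ ρ≤h) h≤hm)) (ℤ.+≤+ z≤n)) m>0
  }
  where
  open ℤSolver.+-*-Solver
  h≤hm : + h ℤ.≤ + h ℤ.* m
  h≤hm = subst (ℤ._≤ + h ℤ.* m) (ℤP.*-identityʳ (+ h)) (ℤP.*-monoˡ-≤-nonNeg (+ h) (ℤP.i<j⇒suc[i]≤j m>0))
  identity : ∀ H R t m u e d →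
    (H ℤ.* m ℤ.- R ℤ.+ R ℤ.+ m) ℤ.* (u ℤ.+ e ℤ.+ ℤ.- t ℤ.* d)
      ≡ (H ℤ.* m ℤ.- R) ℤ.* u ℤ.+ R ℤ.* (u ℤ.+ (0ℤ ℤ.* e ℤ.+ m ℤ.* d))
        ℤ.+ m ℤ.* (u ℤ.+ ((1ℤ ℤ.+ H) ℤ.* e ℤ.+ ℤ.- (R ℤ.+ t ℤ.* (1ℤ ℤ.+ H)) ℤ.* d))
  identity = solve 7 (λ H R t m u e d →
    (H :* m :- R :+ R :+ m) :* (u :+ e :+ :- t :* d)
      := (H :* m :- R) :* u :+ R :* (u :+ (con 0ℤ :* e :+ m :* d))
         :+ m :* (u :+ ((con 1ℤ :+ H) :* e :+ :- (R :+ t :* (con 1ℤ :+ H)) :* d))) refl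

lattice-point-between : ∀ {a a₀} → Coprime ∣ proj₁ a ∣ ∣ proj₂ a ∣ → ∀ {u v x} →
  a ∙ u ≡ a₀ → a ∙ v ≡ a₀ → u ≢ v → a₀ ℤ.< a ∙ x →
  Σ ℤ² λ Y → a ∙ Y ≡ a₀ ℤ.+ 1ℤ × InTriangle u v x Y
lattice-point-between {a} {a₀} coprime {u} {v} {x} a∙u≡a₀ a∙v≡a₀ u≢v a₀<a∙x =
  by-orientation (ℤP.<-cmp 0ℤ (cross e (v -ᵥ u)))
  where
  e : ℤ²
  e = proj₁ (bezout a coprime)
  a∙e≡1 : a ∙ e ≡ 1ℤ
  a∙e≡1 = proj₂ (bezout a coprime)
  along-edge : ∀ {u v} → a ∙ u ≡ a₀ → a ∙ v ≡ a₀ → v ≡ u +ᵥ (0ℤ • e +ᵥ cross e (v -ᵥ u) • perp a)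
  along-edge {u} {v} a∙u≡a₀ a∙v≡a₀ = trans (decompose {a} {e} a∙e≡1 u v)
    (cong (λ s → u +ᵥ (s • e +ᵥ cross e (v -ᵥ u) • perp a))
      (trans (cong₂ ℤ._-_ a∙v≡a₀ a∙u≡a₀) (ℤP.+-inverseʳ a₀)))
  height : Σ ℕ λ h → a ∙ x ℤ.- a₀ ≡ + suc h
  height = positive⇒+[1+] (i<j⇒0<j-i a₀<a∙x)
  oriented : ∀ {u v} → a ∙ u ≡ a₀ → a ∙ v ≡ a₀ → 0ℤ ℤ.< cross e (v -ᵥ u) →
    (Σ ℕ λ h → a ∙ x ℤ.- a₀ ≡ + suc h) → Σ ℤ² λ Y → a ∙ Y ≡ a₀ ℤ.+ 1ℤ × InTriangle u v x Y
  oriented {u} {v} a∙u≡a₀ a∙v≡a₀ m>0 (h , a∙x-a₀≡1+h) =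
    Y , trans (∙-along-perp a u e (ℤ.- t)) (cong₂ ℤ._+_ a∙u≡a₀ a∙e≡1) ,
    subst₂ (λ v′ x′ → InTriangle u v′ x′ Y) (sym (along-edge a∙u≡a₀ a∙v≡a₀)) (sym x≡)
      (lattice-core a e u h ρ t (cross e (v -ᵥ u)) (ℕP.≤-pred (n%ℕd<d (ℤ.- σ) (suc h))) m>0)
    where
    σ : ℤ
    σ = cross e (x -ᵥ u)
    ρ : ℕ
    ρ = (ℤ.- σ) %ℕ suc h
    t : ℤ
    t = (ℤ.- σ) /ℕ suc h
    Y : ℤ²
    Y = u +ᵥ e +ᵥ ℤ.- t • perp a
    x≡ : x ≡ u +ᵥ (+ suc h • e +ᵥ ℤ.- (+ ρ ℤ.+ t ℤ.* + suc h) • perp a)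
    x≡ = trans (decompose {a} {e} a∙e≡1 u x) (cong₂ (λ s s′ → u +ᵥ (s • e +ᵥ s′ • perp a))
      (trans (cong (λ c → a ∙ x ℤ.- c) a∙u≡a₀) a∙x-a₀≡1+h)
      (trans (sym (ℤP.neg-involutive σ)) (cong ℤ.-_ (a≡a%ℕn+[a/ℕn]*n (ℤ.- σ) (suc h)))))
  by-orientation : Tri (0ℤ ℤ.< cross e (v -ᵥ u)) (0ℤ ≡ cross e (v -ᵥ u)) (cross e (v -ᵥ u) ℤ.< 0ℤ) →
    Σ ℤ² λ Y → a ∙ Y ≡ a₀ ℤ.+ 1ℤ × InTriangle u v x Y
  by-orientation (tri< m>0 _ _) = oriented a∙u≡a₀ a∙v≡a₀ m>0 height
  by-orientation (tri> _ _ m<0) = Data.Product.map₂ (Data.Product.map₂ InTriangle-swap)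
    (oriented a∙v≡a₀ a∙u≡a₀ (subst (0ℤ ℤ.<_) (sym (cross-flip e u v)) (ℤP.neg-mono-< m<0)) height)
  by-orientation (tri≈ _ 0≡m _) = ⊥-elim (u≢v (sym (trans (along-edge a∙u≡a₀ a∙v≡a₀)
    (trans (cong (λ m → u +ᵥ (0ℤ • e +ᵥ m • perp a)) (sym 0≡m))
      (cong₂ _,_ (ℤP.+-identityʳ (proj₁ u)) (ℤP.+-identityʳ (proj₂ u)))))))

triangle⇒InConv : ∀ {N} {S : E (suc N) → Set} {u v x : E (suc N)} → S u → S v → S x → ∀ {Y} →
  InTriangle (pos u) (pos v) (pos x) Y → Σ (E (suc N)) λ y → pos y ≡ Y × InConv S y
triangle⇒InConv {N} {S} {u} {v} {x} Su Sv Sx {Y₁ , Y₂} T =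
  (proj₁ y₁ , proj₁ y₂) , cong₂ _,_ (proj₂ y₁) (proj₂ y₂) ,
  3 , w , q , w≥0 , Sq , Σw≡1 ,
  trans combination₁ (cong fromℤ (sym (proj₂ y₁))) , trans combination₂ (cong fromℤ (sym (proj₂ y₂)))
  where
  open InTriangle T
  D>0 : 0ℚ ℚ.< fromℤ α ℚ.+ fromℤ β ℚ.+ fromℤ γ
  D>0 = subst (0ℚ ℚ.<_) (fromℤ-sum α β γ) (fromℤ-mono-< total>0)
  instance
    D-nonZero : ℚ.NonZero (fromℤ α ℚ.+ fromℤ β ℚ.+ fromℤ γ)
    D-nonZero = ℚP.pos⇒nonZero (fromℤ α ℚ.+ fromℤ β ℚ.+ fromℤ γ) {{ℚ.positive D>0}}
  D⁻¹ : ℚ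
  D⁻¹ = ℚ.1/ (fromℤ α ℚ.+ fromℤ β ℚ.+ fromℤ γ)
  D⁻¹D≡1 : D⁻¹ ℚ.* (fromℤ α ℚ.+ fromℤ β ℚ.+ fromℤ γ) ≡ 1ℚ
  D⁻¹D≡1 = ℚP.*-inverseˡ (fromℤ α ℚ.+ fromℤ β ℚ.+ fromℤ γ)
  D⁻¹≥0 : 0ℚ ℚ.≤ D⁻¹
  D⁻¹≥0 = ℚP.<⇒≤ (ℚP.positive⁻¹ D⁻¹
    {{ℚP.1/pos⇒pos (fromℤ α ℚ.+ fromℤ β ℚ.+ fromℤ γ) {{ℚ.positive D>0}}}})
  w : Fin 3 → ℚ
  w fzero               = fromℤ α ℚ.* D⁻¹
  w (fsuc fzero)        = fromℤ β ℚ.* D⁻¹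
  w (fsuc (fsuc fzero)) = fromℤ γ ℚ.* D⁻¹
  q : Fin 3 → E (suc N)
  q fzero               = u
  q (fsuc fzero)        = v
  q (fsuc (fsuc fzero)) = x
  w≥0 : ∀ i → 0ℚ ℚ.≤ w i
  w≥0 fzero               = ℚ-*-nonNeg (fromℤ-mono-≤ α≥0) D⁻¹≥0
  w≥0 (fsuc fzero)        = ℚ-*-nonNeg (fromℤ-mono-≤ β≥0) D⁻¹≥0
  w≥0 (fsuc (fsuc fzero)) = ℚ-*-nonNeg (fromℤ-mono-≤ γ≥0) D⁻¹≥0
  Sq : ∀ i → S (q i)
  Sq fzero               = Su
  Sq (fsuc fzero)        = Sv
  Sq (fsuc (fsuc fzero)) = Sx
  Σw≡1 : Σℚ 3 w ≡ 1ℚ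
  Σw≡1 = normalised-weights {fromℤ α} {fromℤ β} {fromℤ γ} D⁻¹ D⁻¹D≡1
  coordinate : ∀ {Yⱼ} (pⱼ : E (suc N) → ℤ) →
    (α ℤ.+ β ℤ.+ γ) ℤ.* Yⱼ ≡ α ℤ.* pⱼ u ℤ.+ β ℤ.* pⱼ v ℤ.+ γ ℤ.* pⱼ x →
    Σℚ 3 (λ i → w i ℚ.* fromℤ (pⱼ (q i))) ≡ fromℤ Yⱼ
  coordinate {Yⱼ} pⱼ DY≡ = normalised-combination {fromℤ α} {fromℤ β} {fromℤ γ} D⁻¹ D⁻¹D≡1
    {fromℤ (pⱼ u)} {fromℤ (pⱼ v)} {fromℤ (pⱼ x)} {fromℤ Yⱼ}
    (trans (sym (trans (fromℤ-* (α ℤ.+ β ℤ.+ γ) Yⱼ) (cong (ℚ._* fromℤ Yⱼ) (fromℤ-sum α β γ))))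
      (trans (cong fromℤ DY≡) (fromℤ-combination α β γ (pⱼ u) (pⱼ v) (pⱼ x))))
  combination₁ : Σℚ 3 (λ i → w i ℚ.* x₁ℚ (q i)) ≡ fromℤ Y₁
  combination₁ = coordinate x₁ℤ (cong proj₁ barycentre)
  combination₂ : Σℚ 3 (λ i → w i ℚ.* x₂ℚ (q i)) ≡ fromℤ Y₂
  combination₂ = coordinate x₂ℤ (cong proj₂ barycentre)
  y₁ : Σ (Fin (suc N)) λ j → + toℕ j ≡ Y₁
  y₁ = Average.in-Fin w≥0 Σw≡1 (proj₁ ∘ q) combination₁
  y₂ : Σ (Fin (suc N)) λ j → + toℕ j ≡ Y₂
  y₂ = Average.in-Fin w≥0 Σw≡1 (proj₂ ∘ q) combination₂

next-line-point : ∀ {N} {f : BFun (suc N)} {a₁ a₂ a₀} → EdgeIneq f a₁ a₂ a₀ → ∀ x → a₀ ℤ.< lin a₁ a₂ x →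
  Σ (E (suc N)) λ y → lin a₁ a₂ y ≡ a₀ ℤ.+ 1ℤ × M f false y × InConv (λ q → M f true q ⊎ q ≡ x) y
next-line-point {N} {f} {a₁} {a₂} {a₀} (coprime , valid , u , v , u≢v , u∈M₁ , v∈M₁ , u-on-edge , v-on-edge) x a₀<ax =
  in-grid (lattice-point-between {a₁ , a₂} coprime u-on-edge v-on-edge (u≢v ∘ pos-injective) a₀<ax)
  where
  in-grid : Σ ℤ² (λ Y → (a₁ , a₂) ∙ Y ≡ a₀ ℤ.+ 1ℤ × InTriangle (pos u) (pos v) (pos x) Y) →
    Σ (E (suc N)) λ y → lin a₁ a₂ y ≡ a₀ ℤ.+ 1ℤ × M f false y × InConv (λ q → M f true q ⊎ q ≡ x) y
  in-grid (Y , aY≡a₀+1 , u-v-x∋Y) =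
    conclude (triangle⇒InConv {S = λ q → M f true q ⊎ q ≡ x} (inj₁ u∈M₁) (inj₁ v∈M₁) (inj₂ refl) u-v-x∋Y)
    where
    conclude : Σ (E (suc N)) (λ y → pos y ≡ Y × InConv (λ q → M f true q ⊎ q ≡ x) y) →
      Σ (E (suc N)) λ y → lin a₁ a₂ y ≡ a₀ ℤ.+ 1ℤ × M f false y × InConv (λ q → M f true q ⊎ q ≡ x) y
    conclude (y , refl , y∈conv) = y , aY≡a₀+1 ,
      BoolP.¬-not (λ fy≡true → ℤP.<⇒≱ (i<i+1 a₀) (subst (ℤ._≤ a₀) aY≡a₀+1 (valid y fy≡true))) , y∈conv

D⊆ΔP∩M₀ : ∀ {N} {f : BFun (suc N)} → InT2 (suc N) f → ∀ x → InD f x → InΔP f x × M f false x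
D⊆ΔP∩M₀ {N} {f} T x (fx≡false , isolated) = (x∈P′ , x∉P) , fx≡false
  where
  x∉P : ¬ InP f x
  x∉P x∈P = BoolP.not-¬ (InP⇒M₁ T x∈P) fx≡false
  x∈P′ : InP' f x
  x∈P′ a₁ a₂ a₀ edge = decidable-stable (lin a₁ a₂ x ℤ.≤? a₀ ℤ.+ 1ℤ) λ x-beyond →
    no-other-point (ℤP.≰⇒> x-beyond)
      (next-line-point {a₁ = a₁} {a₂} {a₀} edge x (ℤP.<-trans (i<i+1 a₀) (ℤP.≰⇒> x-beyond)))
    where
    no-other-point : a₀ ℤ.+ 1ℤ ℤ.< lin a₁ a₂ x →
      Σ (E (suc N)) (λ y → lin a₁ a₂ y ≡ a₀ ℤ.+ 1ℤ × M f false y × InConv (λ q → M f true q ⊎ q ≡ x) y) → ⊥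
    no-other-point a₀+1<ax (y , ay≡a₀+1 , fy≡false , y∈conv) with isolated y fy≡false y∈conv
    ... | refl = ℤP.<-irrefl (sym ay≡a₀+1) a₀+1<ax

proposition4 : (n : ℕ) → 2 ≤ n → (f : BFun n) → InT2 n f → PositiveArea f →
    ∀ x → (InD f x → InΔP f x × M f false x) × (InΔP f x × M f false x → InD f x)
proposition4 (suc N) _ f T area x =
  D⊆ΔP∩M₀ T x , λ ((x∈P′ , _) , fx≡false) → ΔP∩M₀⊆D T area x x∈P′ fx≡false
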